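{- For all even $d>2$ and all $n\equiv 0\pmod 4$, there is a confirmed bachelor Latin hypercube of dimension $d$ and order $n$ that contains a transversal.
   Context: For a positive integer $n$ let $I_n$ be a set of size $n$. A $d$-dimensional hypercube of order $n$ is a map $H:I_n^d\to I_n$; its entries are the tuples $(x_1,\dots,x_d;H(x_1,\dots,x_d))$, with coordinates $(x_1,\dots,x_d)$ and symbol $H(x_1,\dots,x_d)$. A line is obtained by fixing all but one coordinate; a hyperplane by fixing exactly one coordinate. $H$ is Latin if every line contains every element of $I_n$ as a symbol. A diagonal is a set of $n$ entries no two of which lie in a common hyperplane (i.e. no two agree in any coordinate). A transversal is a diagonal whose entries have pairwise distinct symbols. A Latin hypercube is a confirmed bachelor if it has at least one entry that is not contained in any transversal. -}

module Defs where

open import Data.Nat using (ℕ)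
open import Data.Fin using (Fin; _≟_)
open import Relation.Nullary using (yes; no)
open import Data.Product using (Σ; ∃; _×_)
open import Relation.Binary.PropositionalEquality using (_≡_; _≢_)
open import Relation.Nullary using (¬_)
open import Function.Definitions using (Injective)

-- I_n is Fin n.  A coordinate tuple (x_1,…,x_d) ∈ I_n^d is a function Fin d → Fin n.
Coord : ℕ → ℕ → Set
Coord d n = Fin d → Fin n

Hypercube : ℕ → ℕ → Set
Hypercube d n = Coord d n → Fin n

update : ∀ {d n} → Coord d n → Fin d → Fin n → Coord d n
update x i t j with i ≟ j
... | yes _ = t
... | no _ = x j

-- The line through x in direction i is { update x i t | t ∈ I_n }.
-- Latin: every line contains every symbol.
IsLatin : ∀ {d n} → Hypercube d n → Set
IsLatin {d} {n} H =
  (x : Coord d n) (i : Fin d) (s : Fin n) → ∃ λ (t : Fin n) → H (update x i t) ≡ s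

-- A diagonal: n entries (indexed by Fin n, given by their coordinates; the
-- symbol of an entry is determined by H), no two agreeing in any coordinate.
IsDiagonal : ∀ {d n} → (Fin n → Coord d n) → Set
IsDiagonal {d} {n} e = (j : Fin d) → Injective _≡_ _≡_ (λ k → e k j)

IsTransversal : ∀ {d n} → Hypercube d n → (Fin n → Coord d n) → Set
IsTransversal H e = IsDiagonal e × Injective _≡_ _≡_ (λ k → H (e k))

HasTransversal : ∀ {d n} → Hypercube d n → Set
HasTransversal {d} {n} H = ∃ λ (e : Fin n → Coord d n) → IsTransversal H e

InTransversal : ∀ {d n} → Hypercube d n → Coord d n → Set
InTransversal {d} {n} H x =
  ∃ λ (e : Fin n → Coord d n) → IsTransversal H e × ∃ λ (k : Fin n) → ((j : Fin d) → e k j ≡ x j)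

IsConfirmedBachelor : ∀ {d n} → Hypercube d n → Set
IsConfirmedBachelor {d} {n} H = IsLatin H × ∃ λ (x : Coord d n) → ¬ InTransversal H x

-- Let B be a Latin cube of order n and, for odd r, let H(x) = B(x₀,x₁,x₂) + x₃ + ⋯ + x₂₊ᵣ (mod n),
-- a Latin hypercube of dimension 3 + r. The symbols of a transversal of H, like each of its last r
-- coordinates, run through 0, …, n-1 and so sum to T = n(n-1)/2; as 2T ≡ 0 and r is odd, the B-part
-- of a transversal sums to 0 (mod n). Hence an entry whose first three coordinates lie on no diagonal
-- of B with symbol sum ≡ 0 is in no transversal of H. Transversals of H come from a diagonal (a,b,c)
-- of B and a permutation w with B(a,b,c) + w injective, padded by coordinate pairs (k, -k).
-- For n = 4 a suitable B is given by a table; for n = 4m with m ≥ 2 it is B(i,j,l) = i + j + Δ(i,j) + l,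
-- where the perturbation Δ of the cyclic square sums to 0, m, 3m or 4m along any diagonal through
-- (0, n-1, ·), whereas a zero-sum diagonal would need a Δ-sum ≡ 2m.

{-# OPTIONS --safe #-}
module Submission where

open import Defs
open import Data.Nat using (ℕ; _<_; _*_)
open import Data.Product using (∃; _×_)
open import Relation.Binary.PropositionalEquality using (_≡_)

open import Data.Nat using (zero; suc; _+_; _∸_; _%_; _/_; _≤_; _≟_; _<?_; s≤s; z≤n; pred; NonZero)
open import Data.Nat.Properties
open import Data.Nat.DivMod
open import Data.Fin as Fin using (Fin; toℕ; punchOut)
open import Data.Fin.Patterns using (0F; 1F; 2F)
import Data.Fin.Properties as Fin
open import Data.Fin.Permutation using (permutation)
open import Data.Product using (_,_; proj₁; proj₂)
open import Data.Sum using (_⊎_; inj₁; inj₂)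
open import Data.Empty using (⊥-elim)
open import Function.Base using (_∘_)
open import Data.Vec.Functional using (_∷_)
open import Function.Definitions using (Injective)
open import Level using (0ℓ)
open import Relation.Binary.Bundles using (Setoid)
open import Relation.Binary.PropositionalEquality
  using (refl; sym; trans; cong; cong₂; subst; subst₂; _≗_; module ≡-Reasoning)
open import Relation.Nullary using (¬_; Dec; yes; no)
import Relation.Binary.Reasoning.Setoid as SetoidReasoning
open import Data.Nat.Solver using (module +-*-Solver)
open +-*-Solver using (solve; _:+_; _:*_; _:=_; con)
open import Data.Nat.Divisibility using (n∣m*n)
open import Algebra.Properties.CommutativeMonoid.Sum +-0-commutativeMonoid
  using (sum; sum-cong-≗; ∑-distrib-+; ∑-comm; sum-permute)

injective⇒surjective : ∀ {n} (f : Fin n → Fin n) → Injective _≡_ _≡_ f → ∀ y → ∃ λ x → f x ≡ y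
injective⇒surjective {suc n} f f-inj y with Fin.any? (λ x → f x Fin.≟ y)
... | yes hit = hit
... | no miss = ⊥-elim (1+n≰n (Fin.injective⇒≤ g-inj))
  where
  y≢f : ∀ x → ¬ y ≡ f x
  y≢f x y≡fx = miss (x , sym y≡fx)
  g : Fin (suc n) → Fin n
  g x = punchOut (y≢f x)
  g-inj : Injective _≡_ _≡_ g
  g-inj {x} {x′} gx≡gx′ = f-inj (Fin.punchOut-injective (y≢f x) (y≢f x′) gx≡gx′)

sum-injective-reindex : ∀ {n} (f : Fin n → ℕ) (σ : Fin n → Fin n) → Injective _≡_ _≡_ σ →
                        sum (f ∘ σ) ≡ sum f
sum-injective-reindex f σ σ-inj = sym (sum-permute f π)
  where
  σ⁻¹ = λ y → proj₁ (injective⇒surjective σ σ-inj y)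
  π = permutation σ σ⁻¹ (λ y → proj₂ (injective⇒surjective σ σ-inj y))
                        (λ x → σ-inj (proj₂ (injective⇒surjective σ σ-inj (σ x))))

sum-const : ∀ r c → sum {r} (λ _ → c) ≡ r * c
sum-const zero    c = refl
sum-const (suc r) c = cong (c +_) (sum-const r c)

triangular : ℕ → ℕ
triangular n = sum {n} toℕ

triangular-suc : ∀ n → triangular (suc n) ≡ n + triangular n
triangular-suc n = begin
  sum {n} (λ i → 1 + toℕ i)          ≡⟨ ∑-distrib-+ {n} (λ _ → 1) toℕ ⟩
  sum {n} (λ _ → 1) + triangular n   ≡⟨ cong (_+ triangular n) (trans (sum-const n 1) (*-identityʳ n)) ⟩
  n + triangular n                   ∎
  where open ≡-Reasoning

triangular-gauss : ∀ n → triangular n + triangular n + n ≡ n * n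
triangular-gauss zero    = refl
triangular-gauss (suc n) = begin
  triangular (suc n) + triangular (suc n) + suc n  ≡⟨ cong (λ t → t + t + suc n) (triangular-suc n) ⟩
  (n + T) + (n + T) + suc n                        ≡⟨ solve 2 (λ n T → (n :+ T) :+ (n :+ T) :+ (con 1 :+ n)
                                                                := (T :+ T :+ n) :+ (con 1 :+ n :+ n)) refl n T ⟩
  (T + T + n) + (suc n + n)                        ≡⟨ cong (_+ (suc n + n)) (triangular-gauss n) ⟩
  n * n + (suc n + n)                              ≡⟨ solve 1 (λ n → n :* n :+ (con 1 :+ n :+ n) := (con 1 :+ n) :* (con 1 :+ n)) refl n ⟩
  suc n * suc n                                    ∎
  where
  open ≡-Reasoning
  T = triangular n

module Residue (n : ℕ) {{_ : NonZero n}} where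

  -- A record rather than a synonym for a % n ≡ b % n, so that a and b can be inferred.
  infix 4 _≡ₙ_
  record _≡ₙ_ (a b : ℕ) : Set where
    constructor %≡⇒≡ₙ
    field ≡ₙ⇒%≡ : a % n ≡ b % n
  open _≡ₙ_ public

  ≡⇒≡ₙ : ∀ {a b} → a ≡ b → a ≡ₙ b
  ≡⇒≡ₙ a≡b = %≡⇒≡ₙ (cong (_% n) a≡b)

  ≡ₙ-refl : ∀ {a} → a ≡ₙ a
  ≡ₙ-refl = %≡⇒≡ₙ refl

  ≡ₙ-sym : ∀ {a b} → a ≡ₙ b → b ≡ₙ a
  ≡ₙ-sym (%≡⇒≡ₙ eq) = %≡⇒≡ₙ (sym eq)

  ≡ₙ-trans : ∀ {a b c} → a ≡ₙ b → b ≡ₙ c → a ≡ₙ c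
  ≡ₙ-trans (%≡⇒≡ₙ eq) (%≡⇒≡ₙ eq′) = %≡⇒≡ₙ (trans eq eq′)

  ≡ₙ-setoid : Setoid 0ℓ 0ℓ
  ≡ₙ-setoid = record
    { Carrier = ℕ ; _≈_ = _≡ₙ_
    ; isEquivalence = record { refl = ≡ₙ-refl ; sym = ≡ₙ-sym ; trans = ≡ₙ-trans } }

  module ≡ₙ-Reasoning = SetoidReasoning ≡ₙ-setoid

  %-≡ₙ : ∀ a → a % n ≡ₙ a
  %-≡ₙ a = %≡⇒≡ₙ (m%n%n≡m%n a n)

  +-*n-≡ₙ : ∀ a k → a + k * n ≡ₙ a
  +-*n-≡ₙ a k = %≡⇒≡ₙ ([m+kn]%n≡m%n a k n)

  +-cong-≡ₙ : ∀ {a b c d} → a ≡ₙ b → c ≡ₙ d → a + c ≡ₙ b + d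
  +-cong-≡ₙ {a} {b} {c} {d} (%≡⇒≡ₙ a≡b) (%≡⇒≡ₙ c≡d) = %≡⇒≡ₙ (begin
    (a + c) % n          ≡⟨ %-distribˡ-+ a c n ⟩
    (a % n + c % n) % n  ≡⟨ cong₂ (λ x y → (x + y) % n) a≡b c≡d ⟩
    (b % n + d % n) % n  ≡⟨ %-distribˡ-+ b d n ⟨
    (b + d) % n          ∎)
    where open ≡-Reasoning

  +-congˡ-≡ₙ : ∀ a {b c} → b ≡ₙ c → a + b ≡ₙ a + c
  +-congˡ-≡ₙ a = +-cong-≡ₙ (≡ₙ-refl {a})

  +-congʳ-≡ₙ : ∀ {a b} c → a ≡ₙ b → a + c ≡ₙ b + c
  +-congʳ-≡ₙ c a≡b = +-cong-≡ₙ a≡b (≡ₙ-refl {c})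

  +-complement : ∀ c → c + (n ∸ c % n) ≡ suc (c / n) * n
  +-complement c = begin
    c + (n ∸ c % n)                      ≡⟨ cong (_+ (n ∸ c % n)) (trans (m≡m%n+[m/n]*n c n) (+-comm (c % n) _)) ⟩
    (c / n) * n + c % n + (n ∸ c % n)    ≡⟨ +-assoc ((c / n) * n) (c % n) _ ⟩
    (c / n) * n + (c % n + (n ∸ c % n))  ≡⟨ cong ((c / n) * n +_) (m+[n∸m]≡n (m%n≤n c n)) ⟩
    (c / n) * n + n                      ≡⟨ +-comm ((c / n) * n) n ⟩
    suc (c / n) * n                      ∎
    where open ≡-Reasoning

  +-cancelʳ-≡ₙ : ∀ {a b} c → a + c ≡ₙ b + c → a ≡ₙ b
  +-cancelʳ-≡ₙ {a} {b} c a+c≡b+c = begin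
    a                    ≈⟨ +-*n-≡ₙ a (suc (c / n)) ⟨
    a + suc (c / n) * n  ≡⟨ cong (a +_) (+-complement c) ⟨
    a + (c + c′)         ≡⟨ +-assoc a c c′ ⟨
    a + c + c′           ≈⟨ +-congʳ-≡ₙ c′ a+c≡b+c ⟩
    b + c + c′           ≡⟨ +-assoc b c c′ ⟩
    b + (c + c′)         ≡⟨ cong (b +_) (+-complement c) ⟩
    b + suc (c / n) * n  ≈⟨ +-*n-≡ₙ b (suc (c / n)) ⟩
    b                    ∎
    where
    open ≡ₙ-Reasoning
    c′ = n ∸ c % n

  +-cancelˡ-≡ₙ : ∀ a {b c} → a + b ≡ₙ a + c → b ≡ₙ c
  +-cancelˡ-≡ₙ a {b} {c} a+b≡a+c = +-cancelʳ-≡ₙ a (begin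
    b + a  ≡⟨ +-comm b a ⟩
    a + b  ≈⟨ a+b≡a+c ⟩
    a + c  ≡⟨ +-comm a c ⟩
    c + a  ∎)
    where open ≡ₙ-Reasoning

  ≡ₙ⇒≡ : ∀ {a b} → a < n → b < n → a ≡ₙ b → a ≡ b
  ≡ₙ⇒≡ a<n b<n (%≡⇒≡ₙ a≡b) = trans (sym (m<n⇒m%n≡m a<n)) (trans a≡b (m<n⇒m%n≡m b<n))

  toℕ-≡ₙ⇒≡ : ∀ {s t : Fin n} → toℕ s ≡ₙ toℕ t → s ≡ t
  toℕ-≡ₙ⇒≡ {s} {t} = Fin.toℕ-injective ∘ ≡ₙ⇒≡ (Fin.toℕ<n s) (Fin.toℕ<n t)

  toℕ-mod : ∀ a → toℕ (a mod n) ≡ a % n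
  toℕ-mod a = Fin.toℕ-fromℕ< (m%n<n a n)

  toℕ-mod-≡ₙ : ∀ a → toℕ (a mod n) ≡ₙ a
  toℕ-mod-≡ₙ a = ≡ₙ-trans (≡⇒≡ₙ (toℕ-mod a)) (%-≡ₙ a)

  mod-cong : ∀ {a b} → a ≡ₙ b → a mod n ≡ b mod n
  mod-cong {a} {b} (%≡⇒≡ₙ a≡b) = Fin.toℕ-injective (trans (toℕ-mod a) (trans a≡b (sym (toℕ-mod b))))

  mod-injective : ∀ {a b} → a mod n ≡ b mod n → a ≡ₙ b
  mod-injective {a} {b} eq = %≡⇒≡ₙ (trans (sym (toℕ-mod a)) (trans (cong toℕ eq) (toℕ-mod b)))

  +-mod-injectiveˡ : ∀ c {s t : Fin n} → (toℕ s + c) mod n ≡ (toℕ t + c) mod n → s ≡ t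
  +-mod-injectiveˡ c = toℕ-≡ₙ⇒≡ ∘ +-cancelʳ-≡ₙ c ∘ mod-injective

  -_ : Fin n → Fin n
  - k = (n ∸ toℕ k) mod n

  +-inverseʳ-≡ₙ : ∀ k → toℕ k + toℕ (- k) ≡ₙ 0
  +-inverseʳ-≡ₙ k = begin
    toℕ k + toℕ (- k)    ≈⟨ +-congˡ-≡ₙ (toℕ k) (toℕ-mod-≡ₙ (n ∸ toℕ k)) ⟩
    toℕ k + (n ∸ toℕ k)  ≡⟨ m+[n∸m]≡n (<⇒≤ (Fin.toℕ<n k)) ⟩
    n                    ≡⟨ +-identityʳ n ⟨
    0 + 1 * n            ≈⟨ +-*n-≡ₙ 0 1 ⟩
    0                    ∎
    where open ≡ₙ-Reasoning

  neg-injective : Injective _≡_ _≡_ -_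
  neg-injective {k} {k′} -k≡-k′ = toℕ-≡ₙ⇒≡ (begin
    toℕ k                            ≡⟨ +-identityʳ (toℕ k) ⟨
    toℕ k + 0                        ≈⟨ +-congˡ-≡ₙ (toℕ k) (+-inverseʳ-≡ₙ k′) ⟨
    toℕ k + (toℕ k′ + toℕ (- k′))    ≡⟨ cong (λ z → toℕ k + (toℕ k′ + toℕ z)) -k≡-k′ ⟨
    toℕ k + (toℕ k′ + toℕ (- k))     ≡⟨ solve 3 (λ a b c → a :+ (b :+ c) := b :+ (a :+ c)) refl (toℕ k) (toℕ k′) (toℕ (- k)) ⟩
    toℕ k′ + (toℕ k + toℕ (- k))     ≈⟨ +-congˡ-≡ₙ (toℕ k′) (+-inverseʳ-≡ₙ k) ⟩
    toℕ k′ + 0                       ≡⟨ +-identityʳ (toℕ k′) ⟩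
    toℕ k′                           ∎)
    where
    open ≡ₙ-Reasoning

  sum-%-≡ₙ : ∀ {r} (f : Fin r → ℕ) → sum (λ i → f i % n) ≡ₙ sum f
  sum-%-≡ₙ {zero}  f = ≡ₙ-refl
  sum-%-≡ₙ {suc r} f = +-cong-≡ₙ (%-≡ₙ (f 0F)) (sum-%-≡ₙ (f ∘ Fin.suc))

  triangular-double-≡ₙ : triangular n + triangular n ≡ₙ 0
  triangular-double-≡ₙ = +-cancelʳ-≡ₙ n (begin
    triangular n + triangular n + n  ≡⟨ triangular-gauss n ⟩
    0 + n * n                        ≈⟨ +-*n-≡ₙ 0 n ⟩
    0                                ≈⟨ +-*n-≡ₙ 0 1 ⟨
    0 + 1 * n                        ≡⟨ cong (0 +_) (*-identityˡ n) ⟩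
    0 + n                            ∎)
    where open ≡ₙ-Reasoning

  triangular-evenMultiple-≡ₙ : ∀ j → j * 2 * triangular n ≡ₙ 0
  triangular-evenMultiple-≡ₙ zero    = ≡ₙ-refl
  triangular-evenMultiple-≡ₙ (suc j) = begin
    T + (T + j * 2 * T)  ≡⟨ +-assoc T T _ ⟨
    T + T + j * 2 * T    ≈⟨ +-cong-≡ₙ triangular-double-≡ₙ (triangular-evenMultiple-≡ₙ j) ⟩
    0                    ∎
    where
    open ≡ₙ-Reasoning
    T = triangular n

update-same : ∀ {d n} (x : Coord d n) i t → update x i t i ≡ t
update-same x i t with i Fin.≟ i
... | yes _  = refl
... | no i≢i = ⊥-elim (i≢i refl)

update-other : ∀ {d n} (x : Coord d n) {i} t {j} → ¬ i ≡ j → update x i t j ≡ x j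
update-other x {i} t {j} i≢j with i Fin.≟ j
... | yes i≡j = ⊥-elim (i≢j i≡j)
... | no _    = refl

update-suc : ∀ {d n} (x : Coord (suc d) n) i t → update x (Fin.suc i) t ∘ Fin.suc ≗ update (x ∘ Fin.suc) i t
update-suc x i t j = by-cases (i Fin.≟ j)
  where
  by-cases : Dec (i ≡ j) → update x (Fin.suc i) t (Fin.suc j) ≡ update (x ∘ Fin.suc) i t j
  by-cases (yes refl) = trans (update-same x (Fin.suc i) t) (sym (update-same (x ∘ Fin.suc) i t))
  by-cases (no i≢j)   = trans (update-other x t (i≢j ∘ Fin.suc-injective)) (sym (update-other (x ∘ Fin.suc) t i≢j))

sum-update : ∀ {r n} (y : Fin r → Fin n) i t →
             sum (toℕ ∘ update y i t) + toℕ (y i) ≡ sum (toℕ ∘ y) + toℕ t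
sum-update y 0F t = solve 3 (λ t Y y₀ → (t :+ Y) :+ y₀ := (y₀ :+ Y) :+ t) refl (toℕ t) (sum (toℕ ∘ y ∘ Fin.suc)) (toℕ (y 0F))
sum-update y (Fin.suc i) t = begin
  (y₀ + sum (toℕ ∘ update y (Fin.suc i) t ∘ Fin.suc)) + toℕ (y′ i)  ≡⟨ cong (λ s → y₀ + s + toℕ (y′ i)) (sum-cong-≗ (cong toℕ ∘ update-suc y i t)) ⟩
  (y₀ + sum (toℕ ∘ update y′ i t)) + toℕ (y′ i)                  ≡⟨ +-assoc y₀ _ _ ⟩
  y₀ + (sum (toℕ ∘ update y′ i t) + toℕ (y′ i))                  ≡⟨ cong (y₀ +_) (sum-update y′ i t) ⟩
  y₀ + (sum (toℕ ∘ y′) + toℕ t)                                  ≡⟨ +-assoc y₀ _ _ ⟨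
  y₀ + sum (toℕ ∘ y′) + toℕ t                                    ∎
  where
  open ≡-Reasoning
  y′ = y ∘ Fin.suc
  y₀ = toℕ (y 0F)

latin-from-injectiveLines : ∀ {d n} (H : Hypercube d n) →
                            (∀ x i → Injective _≡_ _≡_ (λ t → H (update x i t))) → IsLatin H
latin-from-injectiveLines H line-injective x i = injective⇒surjective _ (line-injective x i)

transversal-symbolSum : ∀ {d n} {H : Hypercube d n} {e} → IsTransversal H e →
                        sum (λ k → toℕ (H (e k))) ≡ triangular n
transversal-symbolSum {H = H} {e} (_ , symbols-injective) =
  sum-injective-reindex toℕ (λ k → H (e k)) symbols-injective

record LatinCube {n} (B : Fin n → Fin n → Fin n → Fin n) : Set where
  field
    injective₁ : ∀ y z → Injective _≡_ _≡_ (λ x → B x y z)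
    injective₂ : ∀ x z → Injective _≡_ _≡_ (λ y → B x y z)
    injective₃ : ∀ x y → Injective _≡_ _≡_ (λ z → B x y z)

BachelorWithTransversal : ℕ → ℕ → Set
BachelorWithTransversal d n = ∃ λ (H : Hypercube d n) → IsConfirmedBachelor H × HasTransversal H

module Cube (n : ℕ) {{_ : NonZero n}} (B : Fin n → Fin n → Fin n → Fin n) where

  open Residue n

  pattern 3+_ i = Fin.suc (Fin.suc (Fin.suc i))

  coord : ∀ {r} → Fin n → Fin n → Fin n → (Fin r → Fin n) → Coord (3 + r) n
  coord a b c y 0F     = a
  coord a b c y 1F     = b
  coord a b c y 2F     = c
  coord a b c y (3+ i) = y i

  rest : ∀ {r} → Coord (3 + r) n → ℕ
  rest x = sum (λ i → toℕ (x (3+ i)))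

  extend : ∀ r → Hypercube (3 + r) n
  extend r x = (toℕ (B (x 0F) (x 1F) (x 2F)) + rest x) mod n

  rest-update : ∀ {r} (x : Coord (3 + r) n) i t → rest (update x (3+ i) t) + toℕ (x (3+ i)) ≡ rest x + toℕ t
  rest-update x i t = trans (cong (_+ toℕ (x (3+ i))) (sum-cong-≗ (cong toℕ ∘ update-suc³)))
                            (sum-update (x ∘ 3+_) i t)
    where
    update-suc³ : update x (3+ i) t ∘ 3+_ ≗ update (x ∘ 3+_) i t
    update-suc³ j = trans (update-suc x (Fin.suc (Fin.suc i)) t (Fin.suc (Fin.suc j)))
                   (trans (update-suc (x ∘ Fin.suc) (Fin.suc i) t (Fin.suc j))
                          (update-suc (x ∘ Fin.suc ∘ Fin.suc) i t j))

  extend-latin : LatinCube B → ∀ r → IsLatin (extend r)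
  extend-latin latin r = latin-from-injectiveLines (extend r) line-injective
    where
    open LatinCube latin
    line-injective : ∀ x i → Injective _≡_ _≡_ (λ t → extend r (update x i t))
    line-injective x 0F     = injective₁ (x 1F) (x 2F) ∘ +-mod-injectiveˡ (rest x)
    line-injective x 1F     = injective₂ (x 0F) (x 2F) ∘ +-mod-injectiveˡ (rest x)
    line-injective x 2F     = injective₃ (x 0F) (x 1F) ∘ +-mod-injectiveˡ (rest x)
    line-injective x (3+ i) {t} {t′} eq = toℕ-≡ₙ⇒≡ (+-cancelˡ-≡ₙ (rest x) (begin
      rest x + toℕ t                                   ≡⟨ rest-update x i t ⟨
      rest (update x (3+ i) t) + toℕ (x (3+ i))         ≈⟨ +-congʳ-≡ₙ (toℕ (x (3+ i))) rest≡ ⟩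
      rest (update x (3+ i) t′) + toℕ (x (3+ i))        ≡⟨ rest-update x i t′ ⟩
      rest x + toℕ t′                                  ∎))
      where
      open ≡ₙ-Reasoning
      rest≡ : rest (update x (3+ i) t) ≡ₙ rest (update x (3+ i) t′)
      rest≡ = +-cancelˡ-≡ₙ (toℕ (B (x 0F) (x 1F) (x 2F))) (mod-injective eq)

  extend-transversal₁ : ∀ {a b c w : Fin n → Fin n} →
    Injective _≡_ _≡_ a → Injective _≡_ _≡_ b → Injective _≡_ _≡_ c → Injective _≡_ _≡_ w →
    Injective _≡_ _≡_ (λ k → (toℕ (B (a k) (b k) (c k)) + toℕ (w k)) mod n) →
    HasTransversal (extend 1)
  extend-transversal₁ {a} {b} {c} {w} a-inj b-inj c-inj w-inj symbols-inj =
    e , diagonal , symbols-inj ∘ subst₂ _≡_ (symbol _) (symbol _)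
    where
    e : Fin n → Coord 4 n
    e k = coord (a k) (b k) (c k) (λ _ → w k)
    diagonal : IsDiagonal e
    diagonal 0F      = a-inj
    diagonal 1F      = b-inj
    diagonal 2F      = c-inj
    diagonal (3+ 0F) = w-inj
    symbol : ∀ k → extend 1 (e k) ≡ (toℕ (B (a k) (b k) (c k)) + toℕ (w k)) mod n
    symbol k = cong (λ s → (toℕ (B (a k) (b k) (c k)) + s) mod n) (+-identityʳ (toℕ (w k)))

  extend-transversal-step : ∀ {r} → HasTransversal (extend r) → HasTransversal (extend (2 + r))
  extend-transversal-step {r} (e , diagonal , symbols-inj) =
    e′ , diagonal′ , symbols-inj ∘ subst₂ _≡_ (symbol _) (symbol _)
    where
    e′ : Fin n → Coord (3 + (2 + r)) n
    e′ k = coord (e k 0F) (e k 1F) (e k 2F) (k ∷ (- k) ∷ λ i → e k (3+ i))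
    diagonal′ : IsDiagonal e′
    diagonal′ 0F                         = diagonal 0F
    diagonal′ 1F                         = diagonal 1F
    diagonal′ 2F                         = diagonal 2F
    diagonal′ (3+ 0F)                    = λ eq → eq
    diagonal′ (3+ 1F)                    = neg-injective
    diagonal′ (3+ Fin.suc (Fin.suc i))   = diagonal (3+ i)
    symbol : ∀ k → extend (2 + r) (e′ k) ≡ extend r (e k)
    symbol k = mod-cong (begin
      b + (toℕ k + (toℕ (- k) + rest (e k)))  ≡⟨ cong (b +_) (+-assoc (toℕ k) _ _) ⟨
      b + ((toℕ k + toℕ (- k)) + rest (e k))  ≈⟨ +-congˡ-≡ₙ b (+-congʳ-≡ₙ (rest (e k)) (+-inverseʳ-≡ₙ k)) ⟩
      b + (0 + rest (e k))                     ∎)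
      where
      open ≡ₙ-Reasoning
      b = toℕ (B (e k 0F) (e k 1F) (e k 2F))

  extend-transversal : HasTransversal (extend 1) → ∀ j → HasTransversal (extend (suc (j * 2)))
  extend-transversal base zero    = base
  extend-transversal base (suc j) = extend-transversal-step (extend-transversal base j)

  diagonalSum : (a b c : Fin n → Fin n) → ℕ
  diagonalSum a b c = sum (λ k → toℕ (B (a k) (b k) (c k)))

  ZeroSumFreeAt : Fin n → Fin n → Fin n → Set
  ZeroSumFreeAt α β γ = ∀ {a b c} → Injective _≡_ _≡_ a → Injective _≡_ _≡_ b → Injective _≡_ _≡_ c →
                        ∀ {k} → a k ≡ α → b k ≡ β → c k ≡ γ → ¬ diagonalSum a b c ≡ₙ 0

  zeroSumFreeAt-fromIdentity : ∀ {α β γ} →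
    (∀ {b c} → Injective _≡_ _≡_ b → Injective _≡_ _≡_ c → b α ≡ β → c α ≡ γ → ¬ diagonalSum (λ k → k) b c ≡ₙ 0) →
    ZeroSumFreeAt α β γ
  zeroSumFreeAt-fromIdentity {α} free {a} {b} {c} a-inj b-inj c-inj {k} aₖ≡α bₖ≡β cₖ≡γ zero-sum =
    free (σ-inj ∘ b-inj) (σ-inj ∘ c-inj) (trans (cong b σα≡k) bₖ≡β) (trans (cong c σα≡k) cₖ≡γ)
         (≡ₙ-trans (≡⇒≡ₙ reindexed) zero-sum)
    where
    σ : Fin n → Fin n
    σ i = proj₁ (injective⇒surjective a a-inj i)
    aσ≡id : ∀ i → a (σ i) ≡ i
    aσ≡id i = proj₂ (injective⇒surjective a a-inj i)
    σ-inj : Injective _≡_ _≡_ σ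
    σ-inj {i} {i′} σi≡σi′ = trans (sym (aσ≡id i)) (trans (cong a σi≡σi′) (aσ≡id i′))
    σα≡k : σ α ≡ k
    σα≡k = a-inj (trans (aσ≡id α) (sym aₖ≡α))
    reindexed : diagonalSum (λ i → i) (b ∘ σ) (c ∘ σ) ≡ diagonalSum a b c
    reindexed = trans (sum-cong-≗ (λ i → cong (λ a′ → toℕ (B a′ (b (σ i)) (c (σ i)))) (sym (aσ≡id i))))
                      (sum-injective-reindex (λ k → toℕ (B (a k) (b k) (c k))) σ σ-inj)

  sum-rest : ∀ r (e : Fin n → Coord (3 + r) n) → IsDiagonal e → sum (rest ∘ e) ≡ r * triangular n
  sum-rest r e diagonal = begin
    sum (λ k → sum (λ i → toℕ (e k (3+ i))))  ≡⟨ ∑-comm (λ k i → toℕ (e k (3+ i))) ⟩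
    sum (λ i → sum (λ k → toℕ (e k (3+ i))))  ≡⟨ sum-cong-≗ (λ i → sum-injective-reindex toℕ _ (diagonal (3+ i))) ⟩
    sum {r} (λ _ → triangular n)              ≡⟨ sum-const r (triangular n) ⟩
    r * triangular n                          ∎
    where open ≡-Reasoning

  extend-symbolSum : ∀ r (e : Fin n → Coord (3 + r) n) → IsDiagonal e →
    sum (λ k → toℕ (extend r (e k))) ≡ₙ diagonalSum (λ k → e k 0F) (λ k → e k 1F) (λ k → e k 2F) + r * triangular n
  extend-symbolSum r e diagonal = begin
    sum (λ k → toℕ (extend r (e k)))    ≡⟨ sum-cong-≗ (λ k → toℕ-mod (b k + rest (e k))) ⟩
    sum (λ k → (b k + rest (e k)) % n)  ≈⟨ sum-%-≡ₙ (λ k → b k + rest (e k)) ⟩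
    sum (λ k → b k + rest (e k))        ≡⟨ ∑-distrib-+ b (rest ∘ e) ⟩
    sum b + sum (rest ∘ e)              ≡⟨ cong (sum b +_) (sum-rest r e diagonal) ⟩
    sum b + r * triangular n            ∎
    where
    open ≡ₙ-Reasoning
    b = λ k → toℕ (B (e k 0F) (e k 1F) (e k 2F))

  extend-notInTransversal : ∀ {α β γ} → ZeroSumFreeAt α β γ → ∀ j (x : Coord (3 + suc (j * 2)) n) →
                            x 0F ≡ α → x 1F ≡ β → x 2F ≡ γ → ¬ InTransversal (extend (suc (j * 2))) x
  extend-notInTransversal free j x x₀≡α x₁≡β x₂≡γ (e , transversal@(diagonal , _) , k , eₖ≡x) =
    free (diagonal 0F) (diagonal 1F) (diagonal 2F) {k}
         (trans (eₖ≡x 0F) x₀≡α) (trans (eₖ≡x 1F) x₁≡β) (trans (eₖ≡x 2F) x₂≡γ)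
         (+-cancelʳ-≡ₙ T (begin
           S + T                      ≡⟨ cong (S +_) (+-identityʳ T) ⟨
           S + (T + 0)                ≈⟨ +-congˡ-≡ₙ S (+-congˡ-≡ₙ T (triangular-evenMultiple-≡ₙ j)) ⟨
           S + suc (j * 2) * T        ≈⟨ extend-symbolSum (suc (j * 2)) e diagonal ⟨
           sum (λ k → toℕ (extend (suc (j * 2)) (e k)))  ≡⟨ transversal-symbolSum {H = extend (suc (j * 2))} transversal ⟩
           0 + T                      ∎))
    where
    open ≡ₙ-Reasoning
    T = triangular n
    S = diagonalSum (λ k → e k 0F) (λ k → e k 1F) (λ k → e k 2F)

  extend-bachelor : LatinCube B → HasTransversal (extend 1) → ∀ {α β γ} → ZeroSumFreeAt α β γ →
                    ∀ j → BachelorWithTransversal (3 + suc (j * 2)) n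
  extend-bachelor latin base {α} {β} {γ} free j =
    extend r , (extend-latin latin r , x , extend-notInTransversal free j x refl refl refl) , extend-transversal base j
    where
    r = suc (j * 2)
    x = coord α β γ (λ _ → α)

when : ∀ {P : Set} → Dec P → ℕ → ℕ
when (yes _) a = a
when (no _)  _ = 0

when-yes : ∀ {P : Set} (d : Dec P) a → P → when d a ≡ a
when-yes (yes _) a _  = refl
when-yes (no ¬p) a p = ⊥-elim (¬p p)

when-no : ∀ {P : Set} (d : Dec P) a → ¬ P → when d a ≡ 0
when-no (yes p) a ¬p = ⊥-elim (¬p p)
when-no (no _)  a _  = refl

when-0 : ∀ {P : Set} (d : Dec P) → when d 0 ≡ 0
when-0 (yes _) = refl
when-0 (no _)  = refl

transpose : ℕ → ℕ → ℕ → ℕ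
transpose a b t with t ≟ a | t ≟ b
... | yes _ | _     = b
... | no _  | yes _ = a
... | no _  | no _  = t

transpose-left : ∀ a b → transpose a b a ≡ b
transpose-left a b with a ≟ a
... | yes _ = refl
... | no a≢a = ⊥-elim (a≢a refl)

transpose-right : ∀ a b → transpose a b b ≡ a
transpose-right a b with a ≟ b
... | yes refl = transpose-left a a
... | no a≢b with b ≟ a | b ≟ b
...   | yes b≡a | _      = ⊥-elim (a≢b (sym b≡a))
...   | no _    | yes _  = refl
...   | no _    | no b≢b = ⊥-elim (b≢b refl)

transpose-other : ∀ a b t → ¬ t ≡ a → ¬ t ≡ b → transpose a b t ≡ t
transpose-other a b t t≢a t≢b with t ≟ a | t ≟ b
... | yes t≡a | _     = ⊥-elim (t≢a t≡a)
... | no _    | yes t≡b = ⊥-elim (t≢b t≡b)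
... | no _    | no _  = refl

transpose-involutive : ∀ a b t → transpose a b (transpose a b t) ≡ t
transpose-involutive a b t with t ≟ a | t ≟ b
... | yes refl | _        = transpose-right t b
... | no _     | yes refl = transpose-left a t
... | no t≢a   | no t≢b   = transpose-other a b t t≢a t≢b

transpose-< : ∀ {a b n t} → a < n → b < n → t < n → transpose a b t < n
transpose-< {a} {b} {n} {t} a<n b<n t<n with t ≟ a | t ≟ b
... | yes _ | _     = b<n
... | no _  | yes _ = a<n
... | no _  | no _  = t<n

finMap : ∀ {n} (f : ℕ → ℕ) → (∀ {t} → t < n → f t < n) → Fin n → Fin n
finMap f f< k = Fin.fromℕ< (f< (Fin.toℕ<n k))

toℕ-finMap : ∀ {n} (f : ℕ → ℕ) (f< : ∀ {t} → t < n → f t < n) k → toℕ (finMap f f< k) ≡ f (toℕ k)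
toℕ-finMap f f< k = Fin.toℕ-fromℕ< _

finMap-injective : ∀ {n} (f : ℕ → ℕ) (f< : ∀ {t} → t < n → f t < n) (g : ℕ → ℕ) →
                   (∀ {t} → t < n → g (f t) ≡ t) → Injective _≡_ _≡_ (finMap f f<)
finMap-injective f f< g gf≡id {k} {k′} eq = Fin.toℕ-injective (begin
  toℕ k             ≡⟨ gf≡id (Fin.toℕ<n k) ⟨
  g (f (toℕ k))     ≡⟨ cong g (trans (sym (toℕ-finMap f f< k)) (trans (cong toℕ eq) (toℕ-finMap f f< k′))) ⟩
  g (f (toℕ k′))    ≡⟨ gf≡id (Fin.toℕ<n k′) ⟩
  toℕ k′            ∎)
  where open ≡-Reasoning

sum-zero : ∀ {r} (f : Fin r → ℕ) → (∀ k → f k ≡ 0) → sum f ≡ 0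
sum-zero {zero}  f f≡0 = refl
sum-zero {suc r} f f≡0 = cong₂ _+_ (f≡0 0F) (sum-zero (f ∘ Fin.suc) (f≡0 ∘ Fin.suc))

sum-atMostOne : ∀ {r} (f : Fin r → ℕ) {v} (P : Fin r → Set) → (∀ k → f k ≡ 0 ⊎ (f k ≡ v × P k)) →
                (∀ {k k′} → P k → P k′ → k ≡ k′) → sum f ≡ 0 ⊎ sum f ≡ v
sum-atMostOne {zero}  f P cases unique = inj₁ refl
sum-atMostOne {suc r} f P cases unique with cases 0F
... | inj₂ (f₀≡v , P₀) = inj₂ (trans (cong (_+_ (f 0F)) (sum-zero (f ∘ Fin.suc) tail≡0)) (trans (+-identityʳ _) f₀≡v))
  where
  tail≡0 : ∀ k → f (Fin.suc k) ≡ 0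
  tail≡0 k with cases (Fin.suc k)
  ... | inj₁ fₖ≡0     = fₖ≡0
  ... | inj₂ (_ , Pₖ) with unique P₀ Pₖ
  ...   | ()
... | inj₁ f₀≡0 with sum-atMostOne (f ∘ Fin.suc) (P ∘ Fin.suc) (cases ∘ Fin.suc) (λ p p′ → Fin.suc-injective (unique p p′))
...   | inj₁ tail≡0 = inj₁ (cong₂ _+_ f₀≡0 tail≡0)
...   | inj₂ tail≡v = inj₂ (cong₂ _+_ f₀≡0 tail≡v)

module OrderFour where

  open import Data.Fin.Patterns using (3F)
  open import Relation.Nullary.Decidable using (True; toWitness; _→-dec_; ¬?)
  open Residue 4

  fromValues : Fin 4 → Fin 4 → Fin 4 → Fin 4 → Fin 4 → Fin 4
  fromValues a b c d 0F = a
  fromValues a b c d 1F = b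
  fromValues a b c d 2F = c
  fromValues a b c d 3F = d

  K : Fin 4 → Fin 4 → Fin 4 → Fin 4
  K 0F 0F = fromValues 0F 1F 2F 3F
  K 0F 1F = fromValues 1F 0F 3F 2F
  K 0F 2F = fromValues 2F 3F 0F 1F
  K 0F 3F = fromValues 3F 2F 1F 0F
  K 1F 0F = fromValues 1F 0F 3F 2F
  K 1F 1F = fromValues 0F 1F 2F 3F
  K 1F 2F = fromValues 3F 2F 1F 0F
  K 1F 3F = fromValues 2F 3F 0F 1F
  K 2F 0F = fromValues 2F 3F 0F 1F
  K 2F 1F = fromValues 3F 2F 1F 0F
  K 2F 2F = fromValues 0F 1F 3F 2F
  K 2F 3F = fromValues 1F 0F 2F 3F
  K 3F 0F = fromValues 3F 2F 1F 0F
  K 3F 1F = fromValues 2F 3F 0F 1F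
  K 3F 2F = fromValues 1F 0F 2F 3F
  K 3F 3F = fromValues 0F 1F 3F 2F

  open Cube 4 K

  injective? : (f : Fin 4 → Fin 4) → Dec (∀ x y → f x ≡ f y → x ≡ y)
  injective? f = Fin.all? λ x → Fin.all? λ y → (f x Fin.≟ f y) →-dec (x Fin.≟ y)

  decideInjective : (f : Fin 4 → Fin 4) → {True (injective? f)} → Injective _≡_ _≡_ f
  decideInjective f {decided} {x} {y} = toWitness decided x y

  decideInjectiveLines : (F : Fin 4 → Fin 4 → Fin 4 → Fin 4) →
                         {True (Fin.all? λ y → Fin.all? λ z → injective? (F y z))} → ∀ y z → Injective _≡_ _≡_ (F y z)
  decideInjectiveLines F {decided} y z {x} {x′} = toWitness decided y z x x′

  K-latin : LatinCube K
  K-latin = record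
    { injective₁ = decideInjectiveLines (λ y z x → K x y z)
    ; injective₂ = decideInjectiveLines (λ x z y → K x y z)
    ; injective₃ = decideInjectiveLines (λ x y z → K x y z)
    }

  K-transversal : HasTransversal (extend 1)
  K-transversal = extend-transversal₁ {a = λ k → k} {b} {c} {w} (λ eq → eq)
                    (decideInjective b) (decideInjective c) (decideInjective w)
                    (decideInjective (λ k → (toℕ (K k (b k) (c k)) + toℕ (w k)) mod 4))
    where
    b = fromValues 0F 2F 1F 3F
    c = fromValues 2F 1F 3F 0F
    w = fromValues 0F 2F 1F 3F

  -- A diagonal (id, b, c) through (2,2,2) is determined by the values of b and c away from 2.
  ZeroSumFreeTable : (b₀ b₁ b₃ c₀ c₁ c₃ : Fin 4) → Set
  ZeroSumFreeTable b₀ b₁ b₃ c₀ c₁ c₃ =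
    (∀ x y → b x ≡ b y → x ≡ y) → (∀ x y → c x ≡ c y → x ≡ y) → ¬ diagonalSum (λ k → k) b c % 4 ≡ 0
    where
    b = fromValues b₀ b₁ 2F b₃
    c = fromValues c₀ c₁ 2F c₃

  zeroSumFreeTable : ∀ b₀ b₁ b₃ c₀ c₁ c₃ → ZeroSumFreeTable b₀ b₁ b₃ c₀ c₁ c₃
  zeroSumFreeTable = toWitness {a? = Fin.all? λ b₀ → Fin.all? λ b₁ → Fin.all? λ b₃ →
                                     Fin.all? λ c₀ → Fin.all? λ c₁ → Fin.all? λ c₃ →
                                     injective? (fromValues b₀ b₁ 2F b₃) →-dec (injective? (fromValues c₀ c₁ 2F c₃) →-dec
                                     ¬? (_ ≟ 0))} _

  fromValues-η : (b : Fin 4 → Fin 4) → b 2F ≡ 2F → fromValues (b 0F) (b 1F) 2F (b 3F) ≗ b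
  fromValues-η b b₂≡2 0F = refl
  fromValues-η b b₂≡2 1F = refl
  fromValues-η b b₂≡2 2F = sym b₂≡2
  fromValues-η b b₂≡2 3F = refl

  K-zeroSumFree : ZeroSumFreeAt 2F 2F 2F
  K-zeroSumFree = zeroSumFreeAt-fromIdentity λ {b} {c} b-inj c-inj b₂≡2 c₂≡2 →
    let b≗ = fromValues-η b b₂≡2
        c≗ = fromValues-η c c₂≡2
    in zeroSumFreeTable (b 0F) (b 1F) (b 3F) (c 0F) (c 1F) (c 3F)
         (λ x y → b-inj ∘ subst₂ _≡_ (b≗ x) (b≗ y))
         (λ x y → c-inj ∘ subst₂ _≡_ (c≗ x) (c≗ y))
       ∘ ≡ₙ⇒%≡ ∘ ≡ₙ-trans (≡⇒≡ₙ (sum-cong-≗ λ k → cong₂ (λ u v → toℕ (K k u v)) (b≗ k) (c≗ k)))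

  bachelor : ∀ j → BachelorWithTransversal (3 + suc (j * 2)) 4
  bachelor = extend-bachelor K-latin K-transversal K-zeroSumFree

module OrderFourM (m′ : ℕ) where


  m m-1 n 3m-1 n-1 : ℕ
  m    = suc (suc m′)
  m-1  = suc m′
  n    = 4 * m
  3m-1 = 2 * m + m-1
  n-1  = 3m-1 + m

  open Residue n

  0<m : 0 < m
  0<m = s≤s z≤n

  m<2m : m < 2 * m
  m<2m = subst (m <_) (cong (m +_) (sym (+-identityʳ m))) (m<m+n m 0<m)

  2m<3m : 2 * m < 3 * m
  2m<3m = subst (2 * m <_) (+-comm (2 * m) m) (m<m+n (2 * m) 0<m)

  3m<n : 3 * m < n
  3m<n = subst (3 * m <_) (+-comm (3 * m) m) (m<m+n (3 * m) 0<m)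

  m<n : m < n
  m<n = m<m+n m {3 * m} (s≤s z≤n)

  2m≤3m-1 : 2 * m ≤ 3m-1
  2m≤3m-1 = m≤m+n (2 * m) m-1

  m<3m-1 : m < 3m-1
  m<3m-1 = <-≤-trans m<2m 2m≤3m-1

  3m-1<n-1 : 3m-1 < n-1
  3m-1<n-1 = m<m+n 3m-1 0<m

  3m-1≢n-1 : ¬ 3m-1 ≡ n-1
  3m-1≢n-1 = <⇒≢ 3m-1<n-1

  2m≤n-1 : 2 * m ≤ n-1
  2m≤n-1 = ≤-trans 2m≤3m-1 (<⇒≤ 3m-1<n-1)

  1+3m-1≡3m : suc 3m-1 ≡ 3 * m
  1+3m-1≡3m = solve 1 (λ x → con 1 :+ (con 2 :* (con 2 :+ x) :+ (con 1 :+ x)) := con 3 :* (con 2 :+ x)) refl m′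

  1+n-1≡n : suc n-1 ≡ n
  1+n-1≡n = solve 1 (λ x → con 1 :+ ((con 2 :* (con 2 :+ x) :+ (con 1 :+ x)) :+ (con 2 :+ x)) := con 4 :* (con 2 :+ x)) refl m′

  n-1<n : n-1 < n
  n-1<n = ≤-reflexive 1+n-1≡n

  n≡2*2m : n ≡ 2 * (2 * m)
  n≡2*2m = *-assoc 2 2 m

  n≡2m+2m : n ≡ 2 * m + 2 * m
  n≡2m+2m = solve 1 (λ x → con 4 :* x := con 2 :* x :+ con 2 :* x) refl m

  m%m≡0 : m % m ≡ 0
  m%m≡0 = n%n≡0 m

  3m-1%m : 3m-1 % m ≡ m-1
  3m-1%m = trans (cong (_% m) (+-comm (2 * m) m-1)) (trans ([m+kn]%n≡m%n m-1 2 m) (m<n⇒m%n≡m ≤-refl))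

  n-1%m : n-1 % m ≡ m-1
  n-1%m = trans ([m+n]%n≡m%n 3m-1 m) 3m-1%m

  ≡ₙ⇒%m : ∀ {a b} → a ≡ₙ b → a % m ≡ b % m
  ≡ₙ⇒%m {a} {b} a≡b = trans (sym (m∣n⇒o%n%m≡o%m m n a (n∣m*n 4))) (trans (cong (_% m) (≡ₙ⇒%≡ a≡b)) (m∣n⇒o%n%m≡o%m m n b (n∣m*n 4)))

  m-1≢0 : ¬ m-1 ≡ 0
  m-1≢0 ()

  m%m≢m-1 : ¬ m % m ≡ m-1
  m%m≢m-1 eq = m-1≢0 (trans (sym eq) m%m≡0)

  3m-1%m≢0 : ¬ 3m-1 % m ≡ 0
  3m-1%m≢0 = m-1≢0 ∘ trans (sym 3m-1%m)

  n-1%m≢0 : ¬ n-1 % m ≡ 0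
  n-1%m≢0 = m-1≢0 ∘ trans (sym n-1%m)

  %m≡m-1⇒≢0 : ∀ {i} → i % m ≡ m-1 → ¬ i ≡ 0
  %m≡m-1⇒≢0 i%m≡m-1 refl = m-1≢0 (sym i%m≡m-1)

  %m≡m-1⇒≢m : ∀ {i} → i % m ≡ m-1 → ¬ i ≡ m
  %m≡m-1⇒≢m i%m≡m-1 refl = m%m≢m-1 i%m≡m-1

  %m≡0⇒≢3m-1 : ∀ {j} → j % m ≡ 0 → ¬ j ≡ 3m-1
  %m≡0⇒≢3m-1 j%m≡0 refl = 3m-1%m≢0 j%m≡0

  %m≡0⇒≢n-1 : ∀ {j} → j % m ≡ 0 → ¬ j ≡ n-1
  %m≡0⇒≢n-1 j%m≡0 refl = n-1%m≢0 j%m≡0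

  -- Along each row and each column, Δ is either a multiple of m depending only on the residue mod m,
  -- or adds m and 3m to two cells m apart, which swaps their values mod n; so i + j + Δ i j is Latin.
  Δ₀ Δₘ Δ₋ Δ : ℕ → ℕ → ℕ
  Δ₀ i j = when (i ≟ 0) (when (j % m ≟ 0) m)
  Δₘ i j = when (i ≟ m) (when (j % m ≟ 0) (3 * m))
  Δ₋ i j = when (i % m ≟ m-1) (when (j ≟ 3m-1) m + when (j ≟ n-1) (3 * m))
  Δ i j  = Δ₀ i j + Δₘ i j + Δ₋ i j

  swapShift : ℕ → ℕ → ℕ
  swapShift p t = when (t ≟ p) m + when (t ≟ p + m) (3 * m)

  Δ-parts : ∀ i j {x y z} → Δ₀ i j ≡ x → Δₘ i j ≡ y → Δ₋ i j ≡ z → Δ i j ≡ x + y + z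
  Δ-parts i j p q r = cong₂ _+_ (cong₂ _+_ p q) r

  Δ-row0 : ∀ j → Δ 0 j ≡ when (j % m ≟ 0) m
  Δ-row0 j = trans (+-identityʳ _) (+-identityʳ _)

  Δ-rowm : ∀ j → Δ m j ≡ when (j % m ≟ 0) (3 * m)
  Δ-rowm j = trans (Δ-parts m j refl (when-yes (m ≟ m) _ refl) (when-no (m % m ≟ m-1) _ m%m≢m-1)) (+-identityʳ _)

  Δ-row[m-1] : ∀ i j → i % m ≡ m-1 → Δ i j ≡ swapShift 3m-1 j
  Δ-row[m-1] i j i%m≡m-1 =
    Δ-parts i j (when-no (i ≟ 0) _ (%m≡m-1⇒≢0 i%m≡m-1)) (when-no (i ≟ m) _ (%m≡m-1⇒≢m i%m≡m-1)) (when-yes (i % m ≟ m-1) _ i%m≡m-1)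

  Δ-rowOther : ∀ i j → ¬ i ≡ 0 → ¬ i ≡ m → ¬ i % m ≡ m-1 → Δ i j ≡ 0
  Δ-rowOther i j i≢0 i≢m i%m≢m-1 = Δ-parts i j (when-no (i ≟ 0) _ i≢0) (when-no (i ≟ m) _ i≢m) (when-no (i % m ≟ m-1) _ i%m≢m-1)

  Δ-col[0] : ∀ i j → j % m ≡ 0 → Δ i j ≡ swapShift 0 i
  Δ-col[0] i j j%m≡0 = trans
    (Δ-parts i j (cong (when (i ≟ 0)) (when-yes (j % m ≟ 0) m j%m≡0))
             (cong (when (i ≟ m)) (when-yes (j % m ≟ 0) _ j%m≡0))
             (trans (cong (when (i % m ≟ m-1)) (cong₂ _+_ (when-no (j ≟ 3m-1) m (%m≡0⇒≢3m-1 j%m≡0))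
                                                           (when-no (j ≟ n-1) _ (%m≡0⇒≢n-1 j%m≡0))))
                    (when-0 (i % m ≟ m-1))))
    (+-identityʳ _)

  Δ-col[3m-1] : ∀ i → Δ i 3m-1 ≡ when (i % m ≟ m-1) m
  Δ-col[3m-1] i =
    Δ-parts i 3m-1 (trans (cong (when (i ≟ 0)) (when-no (3m-1 % m ≟ 0) m 3m-1%m≢0)) (when-0 (i ≟ 0)))
            (trans (cong (when (i ≟ m)) (when-no (3m-1 % m ≟ 0) _ 3m-1%m≢0)) (when-0 (i ≟ m)))
            (cong (when (i % m ≟ m-1)) (trans (cong₂ _+_ (when-yes (3m-1 ≟ 3m-1) m refl) (when-no (3m-1 ≟ n-1) _ 3m-1≢n-1))
                                              (+-identityʳ m)))

  Δ-col[n-1] : ∀ i → Δ i n-1 ≡ when (i % m ≟ m-1) (3 * m)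
  Δ-col[n-1] i =
    Δ-parts i n-1 (trans (cong (when (i ≟ 0)) (when-no (n-1 % m ≟ 0) m n-1%m≢0)) (when-0 (i ≟ 0)))
            (trans (cong (when (i ≟ m)) (when-no (n-1 % m ≟ 0) _ n-1%m≢0)) (when-0 (i ≟ m)))
            (cong (when (i % m ≟ m-1)) (cong₂ _+_ (when-no (n-1 ≟ 3m-1) m (3m-1≢n-1 ∘ sym)) (when-yes (n-1 ≟ n-1) _ refl)))

  Δ-colOther : ∀ i j → ¬ j % m ≡ 0 → ¬ j ≡ 3m-1 → ¬ j ≡ n-1 → Δ i j ≡ 0
  Δ-colOther i j j%m≢0 j≢3m-1 j≢n-1 =
    Δ-parts i j (trans (cong (when (i ≟ 0)) (when-no (j % m ≟ 0) m j%m≢0)) (when-0 (i ≟ 0)))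
            (trans (cong (when (i ≟ m)) (when-no (j % m ≟ 0) _ j%m≢0)) (when-0 (i ≟ m)))
            (trans (cong (when (i % m ≟ m-1)) (cong₂ _+_ (when-no (j ≟ 3m-1) m j≢3m-1) (when-no (j ≟ n-1) _ j≢n-1)))
                   (when-0 (i % m ≟ m-1)))

  when-%m : ∀ {P : Set} (d : Dec P) {a} → a % m ≡ 0 → when d a % m ≡ 0
  when-%m (yes _) a%m≡0 = a%m≡0
  when-%m (no _)  _     = refl

  ShiftInjective : (ℕ → ℕ) → Set
  ShiftInjective δ = ∀ {s t} → s < n → t < n → s + δ s ≡ₙ t + δ t → s ≡ t

  zeroShift-injective : ∀ (δ : ℕ → ℕ) → (∀ t → δ t ≡ 0) → ShiftInjective δ
  zeroShift-injective δ δ≡0 {s} {t} s<n t<n eq =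
    ≡ₙ⇒≡ s<n t<n (+-cancelʳ-≡ₙ 0 (subst₂ (λ u v → s + u ≡ₙ t + v) (δ≡0 s) (δ≡0 t) eq))

  periodicShift-injective : ∀ (δ : ℕ → ℕ) (g : ℕ → ℕ) → (∀ t → δ t ≡ g (t % m)) → (∀ r → g r % m ≡ 0) → ShiftInjective δ
  periodicShift-injective δ g δ≡g g%m≡0 {s} {t} s<n t<n eq =
    ≡ₙ⇒≡ s<n t<n (+-cancelʳ-≡ₙ (δ s) (subst (λ z → s + δ s ≡ₙ t + z) (sym δs≡δt) eq))
    where
    +δ-%m : ∀ x → (x + δ x) % m ≡ x % m
    +δ-%m x = begin
      (x + δ x) % m          ≡⟨ %-distribˡ-+ x (δ x) m ⟩
      (x % m + δ x % m) % m  ≡⟨ cong (λ z → (x % m + z) % m) (trans (cong (_% m) (δ≡g x)) (g%m≡0 (x % m))) ⟩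
      (x % m + 0) % m        ≡⟨ cong (_% m) (+-identityʳ (x % m)) ⟩
      x % m % m              ≡⟨ m%n%n≡m%n x m ⟩
      x % m                  ∎
      where open ≡-Reasoning
    δs≡δt : δ s ≡ δ t
    δs≡δt = trans (δ≡g s) (trans (cong g (trans (sym (+δ-%m s)) (trans (≡ₙ⇒%m eq) (+δ-%m t)))) (sym (δ≡g t)))

  swapShift≡ₙtranspose : ∀ (δ : ℕ → ℕ) p → δ ≗ swapShift p →
                         ∀ t → t + δ t ≡ₙ transpose p (p + m) t
  swapShift≡ₙtranspose δ p δ≡ t = by-cases (t ≟ p) (t ≟ p + m)
    where
    open ≡ₙ-Reasoning
    p≢p+m : ¬ p ≡ p + m
    p≢p+m = <⇒≢ (m<m+n p 0<m)
    by-cases : Dec (t ≡ p) → Dec (t ≡ p + m) → t + δ t ≡ₙ transpose p (p + m) t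
    by-cases (yes t≡p) _ = begin
      t + δ t                ≡⟨ cong (t +_) (trans (δ≡ t) (cong₂ _+_ (when-yes (t ≟ p) m t≡p)
                                                                 (when-no (t ≟ p + m) _ (p≢p+m ∘ trans (sym t≡p))))) ⟩
      t + (m + 0)            ≡⟨ cong₂ _+_ t≡p (+-identityʳ m) ⟩
      p + m                  ≡⟨ transpose-left p (p + m) ⟨
      transpose p (p + m) p  ≡⟨ cong (transpose p (p + m)) t≡p ⟨
      transpose p (p + m) t  ∎
    by-cases (no t≢p) (yes t≡p+m) = begin
      t + δ t                ≡⟨ cong₂ _+_ t≡p+m (trans (δ≡ t) (cong₂ _+_ (when-no (t ≟ p) m t≢p) (when-yes (t ≟ p + m) _ t≡p+m))) ⟩
      p + m + 3 * m          ≡⟨ solve 2 (λ p x → p :+ x :+ con 3 :* x := p :+ con 1 :* (con 4 :* x)) refl p m ⟩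
      p + 1 * n              ≈⟨ +-*n-≡ₙ p 1 ⟩
      p                      ≡⟨ transpose-right p (p + m) ⟨
      transpose p (p + m) (p + m)  ≡⟨ cong (transpose p (p + m)) t≡p+m ⟨
      transpose p (p + m) t  ∎
    by-cases (no t≢p) (no t≢p+m) = begin
      t + δ t                ≡⟨ cong (t +_) (trans (δ≡ t) (cong₂ _+_ (when-no (t ≟ p) m t≢p) (when-no (t ≟ p + m) _ t≢p+m))) ⟩
      t + 0                  ≡⟨ +-identityʳ t ⟩
      t                      ≡⟨ transpose-other p (p + m) t t≢p t≢p+m ⟨
      transpose p (p + m) t  ∎

  swapShift-injective : ∀ (δ : ℕ → ℕ) p → p + m < n → δ ≗ swapShift p → ShiftInjective δ
  swapShift-injective δ p p+m<n δ≡ {s} {t} s<n t<n eq = begin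
    s          ≡⟨ transpose-involutive p (p + m) s ⟨
    τ (τ s)    ≡⟨ cong τ (≡ₙ⇒≡ (τ< s<n) (τ< t<n) (≡ₙ-trans (≡ₙ-sym (shift≡τ s)) (≡ₙ-trans eq (shift≡τ t)))) ⟩
    τ (τ t)    ≡⟨ transpose-involutive p (p + m) t ⟩
    t          ∎
    where
    open ≡-Reasoning
    τ = transpose p (p + m)
    τ< : ∀ {t} → t < n → τ t < n
    τ< = transpose-< (<-trans (m<m+n p 0<m) p+m<n) p+m<n
    shift≡τ = swapShift≡ₙtranspose δ p δ≡

  row-injective : ∀ i → ShiftInjective (Δ i)
  row-injective i = by-cases (i ≟ 0) (i ≟ m) (i % m ≟ m-1)
    where
    by-cases : Dec (i ≡ 0) → Dec (i ≡ m) → Dec (i % m ≡ m-1) → ShiftInjective (Δ i)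
    by-cases (yes i≡0) _ _ = subst (ShiftInjective ∘ Δ) (sym i≡0)
      (periodicShift-injective (Δ 0) (λ r → when (r ≟ 0) m) Δ-row0 (λ r → when-%m (r ≟ 0) m%m≡0))
    by-cases (no _) (yes i≡m) _ = subst (ShiftInjective ∘ Δ) (sym i≡m)
      (periodicShift-injective (Δ m) (λ r → when (r ≟ 0) (3 * m)) Δ-rowm (λ r → when-%m (r ≟ 0) (m*n%n≡0 3 m)))
    by-cases (no _) (no _) (yes i%m≡m-1) =
      swapShift-injective (Δ i) 3m-1 n-1<n (λ t → Δ-row[m-1] i t i%m≡m-1)
    by-cases (no i≢0) (no i≢m) (no i%m≢m-1) =
      zeroShift-injective (Δ i) (λ t → Δ-rowOther i t i≢0 i≢m i%m≢m-1)

  column-injective : ∀ j → ShiftInjective (λ i → Δ i j)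
  column-injective j = by-cases (j % m ≟ 0) (j ≟ 3m-1) (j ≟ n-1)
    where
    by-cases : Dec (j % m ≡ 0) → Dec (j ≡ 3m-1) → Dec (j ≡ n-1) → ShiftInjective (λ i → Δ i j)
    by-cases (yes j%m≡0) _ _ =
      swapShift-injective (λ i → Δ i j) 0 m<n (λ i → Δ-col[0] i j j%m≡0)
    by-cases (no _) (yes j≡3m-1) _ = subst (λ j → ShiftInjective (λ i → Δ i j)) (sym j≡3m-1)
      (periodicShift-injective (λ i → Δ i 3m-1) (λ r → when (r ≟ m-1) m) Δ-col[3m-1] (λ r → when-%m (r ≟ m-1) m%m≡0))
    by-cases (no _) (no _) (yes j≡n-1) = subst (λ j → ShiftInjective (λ i → Δ i j)) (sym j≡n-1)
      (periodicShift-injective (λ i → Δ i n-1) (λ r → when (r ≟ m-1) (3 * m)) Δ-col[n-1] (λ r → when-%m (r ≟ m-1) (m*n%n≡0 3 m)))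
    by-cases (no j%m≢0) (no j≢3m-1) (no j≢n-1) =
      zeroShift-injective (λ i → Δ i j) (λ i → Δ-colOther i j j%m≢0 j≢3m-1 j≢n-1)

  L : ℕ → ℕ → ℕ
  L i j = i + j + Δ i j

  B : Fin n → Fin n → Fin n → Fin n
  B i j l = (L (toℕ i) (toℕ j) + toℕ l) mod n

  B-latin : LatinCube B
  B-latin = record { injective₁ = injective₁ ; injective₂ = injective₂ ; injective₃ = injective₃ }
    where
    injective₁ : ∀ y z → Injective _≡_ _≡_ (λ x → B x y z)
    injective₁ y z {s} {t} eq = Fin.toℕ-injective (column-injective Y (Fin.toℕ<n s) (Fin.toℕ<n t)
      (+-cancelʳ-≡ₙ (Y + Z)
        (subst₂ _≡ₙ_ (regroup S) (regroup T) (mod-injective eq))))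
      where
      S = toℕ s ; T = toℕ t ; Y = toℕ y ; Z = toℕ z
      regroup : ∀ X → X + Y + Δ X Y + Z ≡ X + Δ X Y + (Y + Z)
      regroup X = solve 4 (λ x y d z → x :+ y :+ d :+ z := x :+ d :+ (y :+ z)) refl X Y (Δ X Y) Z
    injective₂ : ∀ x z → Injective _≡_ _≡_ (λ y → B x y z)
    injective₂ x z {s} {t} eq = Fin.toℕ-injective (row-injective X (Fin.toℕ<n s) (Fin.toℕ<n t)
      (+-cancelʳ-≡ₙ (X + Z)
        (subst₂ _≡ₙ_ (regroup S) (regroup T) (mod-injective eq))))
      where
      S = toℕ s ; T = toℕ t ; X = toℕ x ; Z = toℕ z
      regroup : ∀ Y → X + Y + Δ X Y + Z ≡ Y + Δ X Y + (X + Z)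
      regroup Y = solve 4 (λ x y d z → x :+ y :+ d :+ z := y :+ d :+ (x :+ z)) refl X Y (Δ X Y) Z
    injective₃ : ∀ x y → Injective _≡_ _≡_ (λ z → B x y z)
    injective₃ x y {s} {t} eq = toℕ-≡ₙ⇒≡ (+-cancelˡ-≡ₙ C (mod-injective eq))
      where C = L (toℕ x) (toℕ y)

  -- The transversal is k ↦ (p₁ k, k, -p₁ k, ψ k) with p₁ swapping m and n-1; its k-th symbol is
  -- ≡ V k, and V, listing the even numbers below n and then the odd ones, is injective.
  ψℕ : ℕ → ℕ
  ψℕ t with t ≟ 0 | t ≟ 3m-1 | t ≟ n-1 | t <? 2 * m
  ... | yes _ | _     | _     | _     = 3 * m
  ... | no _  | yes _ | _     | _     = 2 * m
  ... | no _  | no _  | yes _ | _     = 0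
  ... | no _  | no _  | no _  | yes _ = t
  ... | no _  | no _  | no _  | no _  = suc t

  ψℕ⁻¹ : ℕ → ℕ
  ψℕ⁻¹ v with v ≟ 3 * m | v ≟ 2 * m | v ≟ 0 | v <? 2 * m
  ... | yes _ | _     | _     | _     = 0
  ... | no _  | yes _ | _     | _     = 3m-1
  ... | no _  | no _  | yes _ | _     = n-1
  ... | no _  | no _  | no _  | yes _ = v
  ... | no _  | no _  | no _  | no _  = pred v

  ψℕ-3m-1 : ψℕ 3m-1 ≡ 2 * m
  ψℕ-3m-1 with 3m-1 ≟ 0 | 3m-1 ≟ 3m-1
  ... | yes () | _
  ... | no _   | yes _ = refl
  ... | no _   | no 3m-1≢3m-1 = ⊥-elim (3m-1≢3m-1 refl)

  ψℕ-n-1 : ψℕ n-1 ≡ 0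
  ψℕ-n-1 with n-1 ≟ 0 | n-1 ≟ 3m-1 | n-1 ≟ n-1
  ... | yes () | _ | _
  ... | no _   | yes n-1≡3m-1 | _ = ⊥-elim (3m-1≢n-1 (sym n-1≡3m-1))
  ... | no _   | no _ | yes _ = refl
  ... | no _   | no _ | no n-1≢n-1 = ⊥-elim (n-1≢n-1 refl)

  ψℕ-low : ∀ {t} → ¬ t ≡ 0 → t < 2 * m → ψℕ t ≡ t
  ψℕ-low {t} t≢0 t<2m with t ≟ 0 | t ≟ 3m-1 | t ≟ n-1 | t <? 2 * m
  ... | yes t≡0 | _        | _        | _      = ⊥-elim (t≢0 t≡0)
  ... | no _    | yes refl | _        | _      = ⊥-elim (<⇒≱ t<2m 2m≤3m-1)
  ... | no _    | no _     | yes refl | _      = ⊥-elim (<⇒≱ t<2m 2m≤n-1)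
  ... | no _    | no _     | no _     | yes _  = refl
  ... | no _    | no _     | no _     | no t≮2m = ⊥-elim (t≮2m t<2m)

  ψℕ-high : ∀ {t} → ¬ t ≡ 3m-1 → ¬ t ≡ n-1 → 2 * m ≤ t → ψℕ t ≡ suc t
  ψℕ-high {t} t≢3m-1 t≢n-1 2m≤t with t ≟ 0 | t ≟ 3m-1 | t ≟ n-1 | t <? 2 * m
  ... | yes refl | _         | _         | _      = ⊥-elim (<⇒≱ (<-trans 0<m m<2m) 2m≤t)
  ... | no _     | yes t≡3m-1 | _        | _      = ⊥-elim (t≢3m-1 t≡3m-1)
  ... | no _     | no _      | yes t≡n-1 | _      = ⊥-elim (t≢n-1 t≡n-1)
  ... | no _     | no _      | no _      | yes t<2m = ⊥-elim (<⇒≱ t<2m 2m≤t)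
  ... | no _     | no _      | no _      | no _   = refl

  ψℕ<n : ∀ {t} → t < n → ψℕ t < n
  ψℕ<n {t} t<n with t ≟ 0 | t ≟ 3m-1 | t ≟ n-1 | t <? 2 * m
  ... | yes _ | _     | _          | _     = 3m<n
  ... | no _  | yes _ | _          | _     = <-trans 2m<3m 3m<n
  ... | no _  | no _  | yes _      | _     = <-trans 0<m m<n
  ... | no _  | no _  | no _       | yes _ = t<n
  ... | no _  | no _  | no t≢n-1   | no _  = ≤∧≢⇒< t<n (λ 1+t≡n → t≢n-1 (suc-injective (trans 1+t≡n (sym 1+n-1≡n))))

  ψℕ⁻¹-3m : ψℕ⁻¹ (3 * m) ≡ 0
  ψℕ⁻¹-3m with 3 * m ≟ 3 * m
  ... | yes _ = refl
  ... | no 3m≢3m = ⊥-elim (3m≢3m refl)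

  ψℕ⁻¹-2m : ψℕ⁻¹ (2 * m) ≡ 3m-1
  ψℕ⁻¹-2m with 2 * m ≟ 3 * m | 2 * m ≟ 2 * m
  ... | yes 2m≡3m | _     = ⊥-elim (<⇒≢ 2m<3m 2m≡3m)
  ... | no _      | yes _ = refl
  ... | no _      | no 2m≢2m = ⊥-elim (2m≢2m refl)

  ψℕ⁻¹-low : ∀ {t} → ¬ t ≡ 0 → t < 2 * m → ψℕ⁻¹ t ≡ t
  ψℕ⁻¹-low {t} t≢0 t<2m with t ≟ 3 * m | t ≟ 2 * m | t ≟ 0 | t <? 2 * m
  ... | yes t≡3m | _        | _       | _       = ⊥-elim (<⇒≢ (<-trans t<2m 2m<3m) t≡3m)
  ... | no _     | yes t≡2m | _       | _       = ⊥-elim (<⇒≢ t<2m t≡2m)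
  ... | no _     | no _     | yes t≡0 | _       = ⊥-elim (t≢0 t≡0)
  ... | no _     | no _     | no _    | yes _   = refl
  ... | no _     | no _     | no _    | no t≮2m = ⊥-elim (t≮2m t<2m)

  ψℕ⁻¹-high : ∀ {t} → ¬ t ≡ 3m-1 → 2 * m ≤ t → ψℕ⁻¹ (suc t) ≡ t
  ψℕ⁻¹-high {t} t≢3m-1 2m≤t with suc t ≟ 3 * m | suc t ≟ 2 * m | suc t ≟ 0 | suc t <? 2 * m
  ... | yes 1+t≡3m | _          | _      | _          = ⊥-elim (t≢3m-1 (suc-injective (trans 1+t≡3m (sym 1+3m-1≡3m))))
  ... | no _       | yes 1+t≡2m | _      | _          = ⊥-elim (<⇒≢ (s≤s 2m≤t) (sym 1+t≡2m))
  ... | no _       | no _       | yes () | _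
  ... | no _       | no _       | no _   | yes 1+t<2m = ⊥-elim (<⇒≱ 1+t<2m (≤-trans 2m≤t (n≤1+n t)))
  ... | no _       | no _       | no _   | no _       = refl

  ψℕ⁻¹∘ψℕ : ∀ {t} → t < n → ψℕ⁻¹ (ψℕ t) ≡ t
  ψℕ⁻¹∘ψℕ {t} _ with t ≟ 0 | t ≟ 3m-1 | t ≟ n-1 | t <? 2 * m
  ... | yes refl | _         | _        | _        = ψℕ⁻¹-3m
  ... | no _     | yes refl  | _        | _        = ψℕ⁻¹-2m
  ... | no _     | no _      | yes refl | _        = refl
  ... | no t≢0   | no _      | no _     | yes t<2m = ψℕ⁻¹-low t≢0 t<2m
  ... | no _     | no t≢3m-1 | no _     | no t≮2m  = ψℕ⁻¹-high t≢3m-1 (≮⇒≥ t≮2m)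

  ψ : Fin n → Fin n
  ψ = finMap ψℕ ψℕ<n

  ψ-injective : Injective _≡_ _≡_ ψ
  ψ-injective = finMap-injective ψℕ ψℕ<n ψℕ⁻¹ ψℕ⁻¹∘ψℕ

  V : ℕ → ℕ
  V t with t <? 2 * m
  ... | yes _ = 2 * t
  ... | no _  = suc (2 * (t ∸ 2 * m))

  V-low : ∀ {t} → t < 2 * m → V t ≡ 2 * t
  V-low {t} t<2m with t <? 2 * m
  ... | yes _   = refl
  ... | no t≮2m = ⊥-elim (t≮2m t<2m)

  V-high : ∀ {t} → 2 * m ≤ t → V t ≡ suc (2 * (t ∸ 2 * m))
  V-high {t} 2m≤t with t <? 2 * m
  ... | yes t<2m = ⊥-elim (<⇒≱ t<2m 2m≤t)
  ... | no _     = refl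

  V<n : ∀ {t} → t < n → V t < n
  V<n {t} t<n with t <? 2 * m
  ... | yes t<2m = subst (2 * t <_) (sym n≡2*2m) (*-monoʳ-< 2 t<2m)
  ... | no t≮2m  = subst (suc (2 * u) <_) (sym n≡2*2m)
                     (subst (_≤ 2 * (2 * m)) (*-suc 2 u) (*-monoʳ-≤ 2 u<2m))
    where
    u = t ∸ 2 * m
    u<2m : u < 2 * m
    u<2m = +-cancelʳ-< (2 * m) u (2 * m)
             (subst₂ _<_ (sym (m∸n+n≡m (≮⇒≥ t≮2m))) n≡2m+2m t<n)

  V-injective : ∀ {s t} → V s ≡ V t → s ≡ t
  V-injective {s} {t} Vs≡Vt with s <? 2 * m | t <? 2 * m
  ... | yes _    | yes _    = *-cancelˡ-≡ s t 2 Vs≡Vt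
  ... | yes _    | no _     = ⊥-elim (even≢odd s (t ∸ 2 * m) Vs≡Vt)
  ... | no _     | yes _    = ⊥-elim (even≢odd t (s ∸ 2 * m) (sym Vs≡Vt))
  ... | no s≮2m  | no t≮2m  = begin
    s                  ≡⟨ m∸n+n≡m (≮⇒≥ s≮2m) ⟨
    s ∸ 2 * m + 2 * m  ≡⟨ cong (_+ 2 * m) (*-cancelˡ-≡ (s ∸ 2 * m) (t ∸ 2 * m) 2 (suc-injective Vs≡Vt)) ⟩
    t ∸ 2 * m + 2 * m  ≡⟨ m∸n+n≡m (≮⇒≥ t≮2m) ⟩
    t                  ∎
    where open ≡-Reasoning

  transversalSymbol : ℕ → ℕ
  transversalSymbol t = t + Δ (transpose m n-1 t) t + ψℕ t

  transversalSymbol-0 : transversalSymbol 0 ≡ₙ V 0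
  transversalSymbol-0 = ≡ₙ-trans (≡⇒≡ₙ (solve 1 (λ x → x :+ con 0 :+ con 0 :+ con 3 :* x := con 0 :+ con 1 :* (con 4 :* x)) refl m))
                              (+-*n-≡ₙ 0 1)

  transversalSymbol-m : transversalSymbol m ≡ₙ V m
  transversalSymbol-m = ≡⇒≡ₙ (begin
    m + Δ (transpose m n-1 m) m + ψℕ m  ≡⟨ cong₂ (λ d ψm → m + d + ψm) Δ≡0 (ψℕ-low (λ ()) m<2m) ⟩
    m + 0 + m                            ≡⟨ solve 1 (λ x → x :+ con 0 :+ x := con 2 :* x) refl m ⟩
    2 * m                                ≡⟨ V-low m<2m ⟨
    V m                                  ∎)
    where
    open ≡-Reasoning
    Δ≡0 : Δ (transpose m n-1 m) m ≡ 0
    Δ≡0 = trans (cong (λ i → Δ i m) (transpose-left m n-1))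
                (trans (Δ-row[m-1] n-1 m n-1%m)
                       (cong₂ _+_ (when-no (m ≟ 3m-1) m (<⇒≢ m<3m-1)) (when-no (m ≟ n-1) _ (<⇒≢ (<-trans m<3m-1 3m-1<n-1)))))

  transversalSymbol-3m-1 : transversalSymbol 3m-1 ≡ₙ V 3m-1
  transversalSymbol-3m-1 = begin
    3m-1 + Δ (transpose m n-1 3m-1) 3m-1 + ψℕ 3m-1  ≡⟨ cong₂ (λ d ψt → 3m-1 + d + ψt) Δ≡m ψℕ-3m-1 ⟩
    3m-1 + m + 2 * m                                ≡⟨ solve 1 (λ x → con 2 :* (con 2 :+ x) :+ (con 1 :+ x) :+ (con 2 :+ x) :+ con 2 :* (con 2 :+ x)
                                                           := con 1 :+ con 2 :* (con 1 :+ x) :+ con 1 :* (con 4 :* (con 2 :+ x))) refl m′ ⟩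
    suc (2 * m-1) + 1 * n                           ≈⟨ +-*n-≡ₙ (suc (2 * m-1)) 1 ⟩
    suc (2 * m-1)                                   ≡⟨ cong (suc ∘ (2 *_)) (m+n∸m≡n (2 * m) m-1) ⟨
    suc (2 * (3m-1 ∸ 2 * m))                        ≡⟨ V-high 2m≤3m-1 ⟨
    V 3m-1                                          ∎
    where
    open ≡ₙ-Reasoning
    Δ≡m : Δ (transpose m n-1 3m-1) 3m-1 ≡ m
    Δ≡m = trans (cong (λ i → Δ i 3m-1) (transpose-other m n-1 3m-1 (<⇒≢ m<3m-1 ∘ sym) 3m-1≢n-1))
                (trans (Δ-col[3m-1] 3m-1) (when-yes (3m-1 % m ≟ m-1) m 3m-1%m))

  transversalSymbol-n-1 : transversalSymbol n-1 ≡ₙ V n-1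
  transversalSymbol-n-1 = ≡⇒≡ₙ (begin
    n-1 + Δ (transpose m n-1 n-1) n-1 + ψℕ n-1  ≡⟨ cong₂ (λ d ψt → n-1 + d + ψt) Δ≡0 ψℕ-n-1 ⟩
    n-1 + 0 + 0                                 ≡⟨ solve 1 (λ x → con 2 :* (con 2 :+ x) :+ (con 1 :+ x) :+ (con 2 :+ x) :+ con 0 :+ con 0
                                                       := con 1 :+ con 2 :* ((con 1 :+ x) :+ (con 2 :+ x))) refl m′ ⟩
    suc (2 * (m-1 + m))                         ≡⟨ cong (suc ∘ (2 *_)) n-1∸2m ⟨
    suc (2 * (n-1 ∸ 2 * m))                     ≡⟨ V-high 2m≤n-1 ⟨
    V n-1                                       ∎)
    where
    open ≡-Reasoning
    Δ≡0 : Δ (transpose m n-1 n-1) n-1 ≡ 0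
    Δ≡0 = trans (cong (λ i → Δ i n-1) (transpose-right m n-1))
                (trans (Δ-rowm n-1) (when-no (n-1 % m ≟ 0) _ n-1%m≢0))
    n-1∸2m : n-1 ∸ 2 * m ≡ m-1 + m
    n-1∸2m = trans (cong (_∸ 2 * m) (+-assoc (2 * m) m-1 m)) (m+n∸m≡n (2 * m) (m-1 + m))

  Δ-diagonal : ∀ t → ¬ t ≡ 0 → ¬ t ≡ m → ¬ t ≡ 3m-1 → ¬ t ≡ n-1 → Δ t t ≡ 0
  Δ-diagonal t t≢0 t≢m t≢3m-1 t≢n-1 = by-cases (t % m ≟ m-1)
    where
    by-cases : Dec (t % m ≡ m-1) → Δ t t ≡ 0
    by-cases (yes t%m≡m-1) = trans (Δ-row[m-1] t t t%m≡m-1)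
                                   (cong₂ _+_ (when-no (t ≟ 3m-1) m t≢3m-1) (when-no (t ≟ n-1) _ t≢n-1))
    by-cases (no t%m≢m-1)  = Δ-rowOther t t t≢0 t≢m t%m≢m-1

  transversalSymbol-generic : ∀ {t} → ¬ t ≡ 0 → ¬ t ≡ m → ¬ t ≡ 3m-1 → ¬ t ≡ n-1 → transversalSymbol t ≡ₙ V t
  transversalSymbol-generic {t} t≢0 t≢m t≢3m-1 t≢n-1 = by-size (t <? 2 * m)
    where
    Δ≡0 : Δ (transpose m n-1 t) t ≡ 0
    Δ≡0 = trans (cong (λ i → Δ i t) (transpose-other m n-1 t t≢m t≢n-1)) (Δ-diagonal t t≢0 t≢m t≢3m-1 t≢n-1)
    by-size : Dec (t < 2 * m) → transversalSymbol t ≡ₙ V t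
    by-size (yes t<2m) = ≡⇒≡ₙ (begin
      t + Δ (transpose m n-1 t) t + ψℕ t  ≡⟨ cong₂ (λ d ψt → t + d + ψt) Δ≡0 (ψℕ-low t≢0 t<2m) ⟩
      t + 0 + t                            ≡⟨ solve 1 (λ x → x :+ con 0 :+ x := con 2 :* x) refl t ⟩
      2 * t                                ≡⟨ V-low t<2m ⟨
      V t                                  ∎)
      where open ≡-Reasoning
    by-size (no t≮2m) = begin
      t + Δ (transpose m n-1 t) t + ψℕ t  ≡⟨ cong₂ (λ d ψt → t + d + ψt) Δ≡0 (ψℕ-high t≢3m-1 t≢n-1 (≮⇒≥ t≮2m)) ⟩
      t + 0 + suc t                        ≡⟨ cong (λ t → t + 0 + suc t) (m∸n+n≡m (≮⇒≥ t≮2m)) ⟨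
      u + 2 * m + 0 + suc (u + 2 * m)      ≡⟨ solve 2 (λ u x → u :+ con 2 :* x :+ con 0 :+ (con 1 :+ (u :+ con 2 :* x))
                                                       := con 1 :+ con 2 :* u :+ con 1 :* (con 4 :* x)) refl u m ⟩
      suc (2 * u) + 1 * n                  ≈⟨ +-*n-≡ₙ (suc (2 * u)) 1 ⟩
      suc (2 * u)                          ≡⟨ V-high (≮⇒≥ t≮2m) ⟨
      V t                                  ∎
      where
      open ≡ₙ-Reasoning
      u = t ∸ 2 * m

  transversalSymbol≡ₙV : ∀ t → transversalSymbol t ≡ₙ V t
  transversalSymbol≡ₙV t = by-cases (t ≟ 0) (t ≟ m) (t ≟ 3m-1) (t ≟ n-1)
    where
    at : ∀ {s} → s ≡ t → transversalSymbol s ≡ₙ V s → transversalSymbol t ≡ₙ V t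
    at = subst (λ s → transversalSymbol s ≡ₙ V s)
    by-cases : Dec (t ≡ 0) → Dec (t ≡ m) → Dec (t ≡ 3m-1) → Dec (t ≡ n-1) → transversalSymbol t ≡ₙ V t
    by-cases (yes t≡0) _ _ _                  = at (sym t≡0) transversalSymbol-0
    by-cases (no _) (yes t≡m) _ _             = at (sym t≡m) transversalSymbol-m
    by-cases (no _) (no _) (yes t≡3m-1) _     = at (sym t≡3m-1) transversalSymbol-3m-1
    by-cases (no _) (no _) (no _) (yes t≡n-1) = at (sym t≡n-1) transversalSymbol-n-1
    by-cases (no t≢0) (no t≢m) (no t≢3m-1) (no t≢n-1) = transversalSymbol-generic t≢0 t≢m t≢3m-1 t≢n-1

  open Cube n B

  p₁ : Fin n → Fin n
  p₁ = finMap (transpose m n-1) (transpose-< m<n n-1<n)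

  p₁-injective : Injective _≡_ _≡_ p₁
  p₁-injective = finMap-injective (transpose m n-1) (transpose-< m<n n-1<n) (transpose m n-1) (λ _ → transpose-involutive m n-1 _)

  B-transversal : HasTransversal (extend 1)
  B-transversal = extend-transversal₁ {a = p₁} {b = λ k → k} {c = -_ ∘ p₁} {w = ψ}
    p₁-injective (λ eq → eq) (p₁-injective ∘ neg-injective) ψ-injective symbols-injective
    where
    symbol≡ₙV : ∀ k → toℕ (B (p₁ k) k (- p₁ k)) + toℕ (ψ k) ≡ₙ V (toℕ k)
    symbol≡ₙV k = begin
      toℕ (B (p₁ k) k (- p₁ k)) + Ψ      ≈⟨ +-congʳ-≡ₙ Ψ (toℕ-mod-≡ₙ (P + K + Δ P K + N)) ⟩
      P + K + Δ P K + N + Ψ              ≡⟨ solve 5 (λ p k d n ψ → p :+ k :+ d :+ n :+ ψ := k :+ d :+ ψ :+ (p :+ n)) refl P K (Δ P K) N Ψ ⟩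
      K + Δ P K + Ψ + (P + N)            ≈⟨ +-congˡ-≡ₙ (K + Δ P K + Ψ) (+-inverseʳ-≡ₙ (p₁ k)) ⟩
      K + Δ P K + Ψ + 0                  ≡⟨ +-identityʳ _ ⟩
      K + Δ P K + Ψ                      ≡⟨ cong₂ (λ p ψk → K + Δ p K + ψk) (toℕ-finMap (transpose m n-1) (transpose-< m<n n-1<n) k) (toℕ-finMap ψℕ ψℕ<n k) ⟩
      transversalSymbol K                ≈⟨ transversalSymbol≡ₙV K ⟩
      V K                                ∎
      where
      open ≡ₙ-Reasoning
      K = toℕ k ; P = toℕ (p₁ k) ; N = toℕ (- p₁ k) ; Ψ = toℕ (ψ k)
    symbols-injective : Injective _≡_ _≡_ (λ k → (toℕ (B (p₁ k) k (- p₁ k)) + toℕ (ψ k)) mod n)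
    symbols-injective {k} {k′} eq = Fin.toℕ-injective (V-injective (≡ₙ⇒≡ (V<n (Fin.toℕ<n k)) (V<n (Fin.toℕ<n k′))
      (≡ₙ-trans (≡ₙ-sym (symbol≡ₙV k)) (≡ₙ-trans (mod-injective eq) (symbol≡ₙV k′)))))

  β : Fin n
  β = Fin.fromℕ< n-1<n

  module DiagonalThroughCorner {a b : Fin n → Fin n} (a-inj : Injective _≡_ _≡_ a) (b-inj : Injective _≡_ _≡_ b)
                               {k₀ : Fin n} (a₀≡0 : a k₀ ≡ 0F) (b₀≡β : b k₀ ≡ β) where

    row col : Fin n → ℕ
    row = toℕ ∘ a
    col = toℕ ∘ b

    row≡0⇒k₀ : ∀ {k} → row k ≡ 0 → k ≡ k₀
    row≡0⇒k₀ rowₖ≡0 = a-inj (Fin.toℕ-injective (trans rowₖ≡0 (sym (cong toℕ a₀≡0))))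

    col₀≡n-1 : col k₀ ≡ n-1
    col₀≡n-1 = trans (cong toℕ b₀≡β) (Fin.toℕ-fromℕ< n-1<n)

    col≡n-1⇒k₀ : ∀ {k} → col k ≡ n-1 → k ≡ k₀
    col≡n-1⇒k₀ colₖ≡n-1 = b-inj (Fin.toℕ-injective (trans colₖ≡n-1 (sym col₀≡n-1)))

    Δ₀-vanishes : ∀ k → Δ₀ (row k) (col k) ≡ 0
    Δ₀-vanishes k with row k ≟ 0
    ... | no _       = refl
    ... | yes rowₖ≡0 = when-no (col k % m ≟ 0) m (λ colₖ%m≡0 → %m≡0⇒≢n-1 colₖ%m≡0 (trans (cong col (row≡0⇒k₀ rowₖ≡0)) col₀≡n-1))

    Δₘ-cases : ∀ k → Δₘ (row k) (col k) ≡ 0 ⊎ (Δₘ (row k) (col k) ≡ 3 * m × row k ≡ m)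
    Δₘ-cases k with row k ≟ m | col k % m ≟ 0
    ... | no _       | _     = inj₁ refl
    ... | yes _      | no _  = inj₁ refl
    ... | yes rowₖ≡m | yes _ = inj₂ (refl , rowₖ≡m)

    Δ₋-cases : ∀ k → Δ₋ (row k) (col k) ≡ 0 ⊎ (Δ₋ (row k) (col k) ≡ m × col k ≡ 3m-1)
    Δ₋-cases k with row k % m ≟ m-1 | col k ≟ 3m-1 | col k ≟ n-1
    ... | no _        | _             | _             = inj₁ refl
    ... | yes _       | yes colₖ≡3m-1 | no _          = inj₂ (+-identityʳ m , colₖ≡3m-1)
    ... | yes _       | no _          | no _          = inj₁ refl
    ... | yes _       | yes colₖ≡3m-1 | yes colₖ≡n-1  = ⊥-elim (3m-1≢n-1 (trans (sym colₖ≡3m-1) colₖ≡n-1))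
    ... | yes rowₖ%m  | no _          | yes colₖ≡n-1  =
      ⊥-elim (%m≡m-1⇒≢0 rowₖ%m (trans (cong row (col≡n-1⇒k₀ colₖ≡n-1)) (cong toℕ a₀≡0)))

    ΣΔ : ℕ
    ΣΔ = sum (λ k → Δ (row k) (col k))

    ΣΔ-split : ∀ {x y} → sum (λ k → Δₘ (row k) (col k)) ≡ x → sum (λ k → Δ₋ (row k) (col k)) ≡ y → ΣΔ ≡ x + y
    ΣΔ-split {x} {y} Σₘ≡x Σ₋≡y = begin
      ΣΔ                                       ≡⟨ ∑-distrib-+ (λ k → Δ₀ (row k) (col k) + Δₘ (row k) (col k)) (λ k → Δ₋ (row k) (col k)) ⟩
      sum (λ k → Δ₀ (row k) (col k) + Δₘ (row k) (col k)) + sum (λ k → Δ₋ (row k) (col k))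
                                               ≡⟨ cong (_+ sum (λ k → Δ₋ (row k) (col k))) (∑-distrib-+ (λ k → Δ₀ (row k) (col k)) (λ k → Δₘ (row k) (col k))) ⟩
      sum (λ k → Δ₀ (row k) (col k)) + sum (λ k → Δₘ (row k) (col k)) + sum (λ k → Δ₋ (row k) (col k))
                                               ≡⟨ cong₂ _+_ (cong₂ _+_ (sum-zero _ Δ₀-vanishes) Σₘ≡x) Σ₋≡y ⟩
      x + y                                    ∎
      where open ≡-Reasoning

    ΣΔ-cases : (ΣΔ ≡ 0 ⊎ ΣΔ ≡ m) ⊎ (ΣΔ ≡ 3 * m ⊎ ΣΔ ≡ 3 * m + m)
    ΣΔ-cases with sum-atMostOne _ (λ k → row k ≡ m) Δₘ-cases (λ rowₖ≡m rowₖ′≡m → a-inj (Fin.toℕ-injective (trans rowₖ≡m (sym rowₖ′≡m))))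
                | sum-atMostOne _ (λ k → col k ≡ 3m-1) Δ₋-cases (λ colₖ≡ colₖ′≡ → b-inj (Fin.toℕ-injective (trans colₖ≡ (sym colₖ′≡))))
    ... | inj₁ Σₘ≡0  | inj₁ Σ₋≡0 = inj₁ (inj₁ (ΣΔ-split Σₘ≡0 Σ₋≡0))
    ... | inj₁ Σₘ≡0  | inj₂ Σ₋≡m = inj₁ (inj₂ (ΣΔ-split Σₘ≡0 Σ₋≡m))
    ... | inj₂ Σₘ≡3m | inj₁ Σ₋≡0 = inj₂ (inj₁ (trans (ΣΔ-split Σₘ≡3m Σ₋≡0) (+-identityʳ (3 * m))))
    ... | inj₂ Σₘ≡3m | inj₂ Σ₋≡m = inj₂ (inj₂ (ΣΔ-split Σₘ≡3m Σ₋≡m))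

  B-diagonalSum : ∀ {a b c} → Injective _≡_ _≡_ a → Injective _≡_ _≡_ b → Injective _≡_ _≡_ c →
                  diagonalSum a b c ≡ₙ triangular n + triangular n + sum (λ k → Δ (toℕ (a k)) (toℕ (b k))) + triangular n
  B-diagonalSum {a} {b} {c} a-inj b-inj c-inj = begin
    diagonalSum a b c                       ≡⟨ sum-cong-≗ (λ k → toℕ-mod (A k + Bₖ k + D k + C k)) ⟩
    sum (λ k → (A k + Bₖ k + D k + C k) % n)  ≈⟨ sum-%-≡ₙ (λ k → A k + Bₖ k + D k + C k) ⟩
    sum (λ k → A k + Bₖ k + D k + C k)      ≡⟨ ∑-distrib-+ (λ k → A k + Bₖ k + D k) C ⟩
    sum (λ k → A k + Bₖ k + D k) + sum C    ≡⟨ cong (_+ sum C) (∑-distrib-+ (λ k → A k + Bₖ k) D) ⟩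
    sum (λ k → A k + Bₖ k) + sum D + sum C  ≡⟨ cong (λ s → s + sum D + sum C) (∑-distrib-+ A Bₖ) ⟩
    sum A + sum Bₖ + sum D + sum C          ≡⟨ cong₂ (λ s t → s + sum D + t)
                                                 (cong₂ _+_ (sum-injective-reindex toℕ a a-inj) (sum-injective-reindex toℕ b b-inj))
                                                 (sum-injective-reindex toℕ c c-inj) ⟩
    triangular n + triangular n + sum D + triangular n  ∎
    where
    open ≡ₙ-Reasoning
    A Bₖ C D : Fin n → ℕ
    A k = toℕ (a k)
    Bₖ k = toℕ (b k)
    C k = toℕ (c k)
    D k = Δ (A k) (Bₖ k)

  triangular+2m : triangular n + 2 * m ≡ 2 * m * n
  triangular+2m = *-cancelˡ-≡ (triangular n + 2 * m) (2 * m * n) 2 (begin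
    2 * (triangular n + 2 * m)          ≡⟨ solve 2 (λ t x → con 2 :* (t :+ con 2 :* x) := t :+ t :+ con 4 :* x) refl (triangular n) m ⟩
    triangular n + triangular n + n     ≡⟨ triangular-gauss n ⟩
    n * n                               ≡⟨ solve 1 (λ x → (con 4 :* x) :* (con 4 :* x) := con 2 :* (con 2 :* x :* (con 4 :* x))) refl m ⟩
    2 * (2 * m * n)                     ∎)
    where open ≡-Reasoning

  zeroSum⇒ΣΔ≡ₙ2m : ∀ X → triangular n + triangular n + X + triangular n ≡ₙ 0 → X ≡ₙ 2 * m
  zeroSum⇒ΣΔ≡ₙ2m X zero-sum = begin
    X                                 ≈⟨ +-*n-≡ₙ X (3 * (2 * m)) ⟨
    X + 3 * (2 * m) * n               ≡⟨ cong (X +_) (*-assoc 3 (2 * m) n) ⟩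
    X + 3 * (2 * m * n)               ≡⟨ cong (λ s → X + 3 * s) triangular+2m ⟨
    X + 3 * (T + 2 * m)               ≡⟨ solve 3 (λ x t y → x :+ con 3 :* (t :+ con 2 :* y) := t :+ t :+ x :+ t :+ con 6 :* y) refl X T m ⟩
    T + T + X + T + 6 * m             ≈⟨ +-congʳ-≡ₙ (6 * m) zero-sum ⟩
    0 + 6 * m                         ≡⟨ solve 1 (λ x → con 0 :+ con 6 :* x := con 2 :* x :+ con 1 :* (con 4 :* x)) refl m ⟩
    2 * m + 1 * n                     ≈⟨ +-*n-≡ₙ (2 * m) 1 ⟩
    2 * m                             ∎
    where
    open ≡ₙ-Reasoning
    T = triangular n

  ≢2m⇒≢ₙ2m : ∀ {X} → X < n → ¬ X ≡ 2 * m → ¬ X ≡ₙ 2 * m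
  ≢2m⇒≢ₙ2m X<n X≢2m = X≢2m ∘ ≡ₙ⇒≡ X<n (<-trans 2m<3m 3m<n)

  ΣΔ≢ₙ2m : ∀ {X} → (X ≡ 0 ⊎ X ≡ m) ⊎ (X ≡ 3 * m ⊎ X ≡ 3 * m + m) → ¬ X ≡ₙ 2 * m
  ΣΔ≢ₙ2m (inj₁ (inj₁ refl)) = ≢2m⇒≢ₙ2m (<-trans 0<m m<n) (λ ())
  ΣΔ≢ₙ2m (inj₁ (inj₂ refl)) = ≢2m⇒≢ₙ2m m<n (<⇒≢ m<2m)
  ΣΔ≢ₙ2m (inj₂ (inj₁ refl)) = ≢2m⇒≢ₙ2m 3m<n (<⇒≢ 2m<3m ∘ sym)
  ΣΔ≢ₙ2m (inj₂ (inj₂ refl)) = ΣΔ≢ₙ2m {0} (inj₁ (inj₁ refl)) ∘ ≡ₙ-trans (≡ₙ-sym 4m≡ₙ0)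
    where
    4m≡ₙ0 : 3 * m + m ≡ₙ 0
    4m≡ₙ0 = ≡ₙ-trans (≡⇒≡ₙ (solve 1 (λ x → con 3 :* x :+ x := con 0 :+ con 1 :* (con 4 :* x)) refl m)) (+-*n-≡ₙ 0 1)

  B-zeroSumFree : ZeroSumFreeAt 0F β 0F
  B-zeroSumFree a-inj b-inj c-inj a₀≡0 b₀≡β _ zero-sum =
    ΣΔ≢ₙ2m ΣΔ-cases (zeroSum⇒ΣΔ≡ₙ2m ΣΔ (≡ₙ-trans (≡ₙ-sym (B-diagonalSum a-inj b-inj c-inj)) zero-sum))
    where open DiagonalThroughCorner a-inj b-inj a₀≡0 b₀≡β

  bachelor : ∀ j → BachelorWithTransversal (3 + suc (j * 2)) n
  bachelor = extend-bachelor B-latin B-transversal B-zeroSumFree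

bachelor-order4m : ∀ m → 0 < 4 * m → ∀ j → BachelorWithTransversal (3 + suc (j * 2)) (4 * m)
bachelor-order4m (suc zero)     _ = OrderFour.bachelor
bachelor-order4m (suc (suc m′)) _ = OrderFourM.bachelor m′

bachelor-evenDimension : ∀ {n} k → 2 < 2 * k → (∀ j → BachelorWithTransversal (3 + suc (j * 2)) n) →
                         BachelorWithTransversal (2 * k) n
bachelor-evenDimension (suc zero) (s≤s (s≤s ())) _
bachelor-evenDimension {n} (suc (suc j)) _ bachelor =
  subst (λ d → BachelorWithTransversal d n) (*-comm (2 + j) 2) (bachelor j)

theorem2p1 : (d n : ℕ) → 2 < d → 0 < n → (∃ λ (k : ℕ) → d ≡ 2 * k) → (∃ λ (m : ℕ) → n ≡ 4 * m) →
    ∃ λ (H : Hypercube d n) → IsConfirmedBachelor H × HasTransversal H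
theorem2p1 _ _ 2<2k 0<4m (k , refl) (m , refl) = bachelor-evenDimension k 2<2k (bachelor-order4m m 0<4m)
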